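{- Let $\mathscr{U}=(U,\mathcal{A},\lambda)$ be a linear reflexive object in a Cartesian closed differential category $\mathbf{C}$. Then the equational theory $\mathrm{Th}(\mathscr{U})$ is a differential $\lambda$-theory; i.e. $\mathscr{U}$ is a sound model of the untyped differential $\lambda$-calculus.
   Context: Cartesian closed differential categories. A left-additive category is a category whose homsets $\mathbf{C}(A,B)$ are commutative monoids $(+,0)$ with $(g+h)\circ f=g\circ f+h\circ f$ and $0\circ f=0$. A morphism $f$ is additive if $f\circ(g+h)=f\circ g+f\circ h$ and $f\circ 0=0$. A Cartesian left-additive category is a left-additive category with finite products in which projections are additive and pairings of additive maps are additive. A Cartesian differential category is a Cartesian left-additive category with an operator $D$ sending $f:A\to B$ to $D(f):A\times A\to B$ such that: (D1) $D(f+g)=D(f)+D(g)$, $D(0)=0$; (D2) $D(f)\circ\langle h+k,v\rangle=D(f)\circ\langle h,v\rangle+D(f)\circ\langle k,v\rangle$, $D(f)\circ\langle 0,v\rangle=0$; (D3) $D(\mathrm{Id})=\pi_1$, $D(\pi_1)=\pi_1\circ\pi_1$, $D(\pi_2)=\pi_2\circ\pi_1$; (D4) $D(\langle f,g\rangle)=\langle D(f),D(g)\rangle$; (D5) $D(f\circ g)=D(f)\circ\langle D(g),g\circ\pi_2\rangle$; (D6) $D(D(f))\circ\langle\langle g,0\rangle,\langle h,k\rangle\rangle=D(f)\circ\langle g,k\rangle$; (D7) $D(D(f))\circ\langle\langle 0,h\rangle,\langle g,k\rangle\rangle=D(D(f))\circ\langle\langle 0,g\rangle,\langle h,k\rangle\rangle$.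 A Cartesian closed differential category is a Cartesian differential category which is Cartesian closed (exponential $[A\Rightarrow B]$, evaluation $\mathrm{ev}$, currying $\Lambda$) with $\Lambda(f+g)=\Lambda(f)+\Lambda(g)$, $\Lambda(0)=0$, and, for every $f:C\times A\to B$, $D(\Lambda(f))=\Lambda(D(f)\circ\langle\pi_1\times 0_A,\pi_2\times\mathrm{Id}_A\rangle)$. Here $h\times k=\langle h\circ\pi_1,k\circ\pi_2\rangle$ and $\Lambda^-(h)=\mathrm{ev}\circ(h\times\mathrm{Id})$. A morphism $f$ is linear if $D(f)=f\circ\pi_1$. For $f:C\times A\to B$ and $g:C\to A$ put $f\star g=D(f)\circ\langle\langle 0_C,g\circ\pi_1\rangle,\mathrm{Id}_{C\times A}\rangle:C\times A\to B$. Linear reflexive object: a triple $(U,\mathcal{A},\lambda)$ with $\mathcal{A}:U\to[U\Rightarrow U]$, $\lambda:[U\Rightarrow U]\to U$, $\mathcal{A}\circ\lambda=\mathrm{Id}$, both $\mathcal{A}$ and $\lambda$ linear. Syntax. Differential $\lambda$-terms $S,T::=0\mid s\mid s+T$ and simple terms $s,t::=x\mid\lambda x.s\mid sT\mid \mathsf{D}s\cdot t$, taken up to $\alpha$-conversion, associativity/commutativity of $+$, $S+0=S$, and the permutative equality $\mathsf{D}^n s\cdot(t_1,\dots,t_n)=\mathsf{D}^n s\cdot(t_{\sigma(1)},\dots,t_{\sigma(n)})$, where $\mathsf{D}^1s\cdot t=\mathsf{D}s\cdot t$ and $\mathsf{D}^{n+1}s\cdot(t,t_1,\dots,t_n)=\mathsf{D}^n(\mathsf{D}s\cdot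 t)\cdot(t_1,\dots,t_n)$. Abbreviations: $\lambda x.\sum_i s_i=\sum_i\lambda x.s_i$, $(\sum_i s_i)T=\sum_i s_iT$, $\mathsf{D}(\sum_i s_i)\cdot(\sum_j t_j)=\sum_{i,j}\mathsf{D}s_i\cdot t_j$. Free variables as usual ($\mathrm{FV}(\mathsf{D}s\cdot t)=\mathrm{FV}(s)\cup\mathrm{FV}(t)$, $\mathrm{FV}(0)=\emptyset$). $S\{T/x\}$ is capture-free substitution (componentwise on all constructors, $0\{T/x\}=0$). The differential substitution $\frac{\partial S}{\partial x}\cdot T$ is defined by: $\frac{\partial y}{\partial x}\cdot T=T$ if $y=x$, $0$ otherwise; $\frac{\partial (sU)}{\partial x}\cdot T=(\frac{\partial s}{\partial x}\cdot T)U+(\mathsf{D}s\cdot(\frac{\partial U}{\partial x}\cdot T))U$; $\frac{\partial(\lambda y.s)}{\partial x}\cdot T=\lambda y.\frac{\partial s}{\partial x}\cdot T$ ($y\ne x$, $y\notin\mathrm{FV}(T)$); $\frac{\partial(\mathsf{D}^n s\cdot(u_1,\dots,u_n))}{\partial x}\cdot T=\mathsf{D}^n(\frac{\partial s}{\partial x}\cdot T)\cdot(u_1,\dots,u_n)+\sum_{i=1}^n\mathsf{D}^n s\cdot(u_1,\dots,\frac{\partial u_i}{\partial x}\cdot T,\dots,u_n)$; $\frac{\partial 0}{\partial x}\cdot T=0$; $\frac{\partial(s+U)}{\partial x}\cdot T=\frac{\partial s}{\partial x}\cdot T+\frac{\partial U}{\partial x}\cdot T$. A differential $\lambda$-theory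 is a set of equations between differential $\lambda$-terms that is an equivalence relation, compatible (if $s=S$ then $\lambda x.s=\lambda x.S$; if $s=S,T=U$ then $sT=SU$; if $s=S,u=U$ then $\mathsf{D}s\cdot u=\mathsf{D}S\cdot U$; if $s_i=S_i$ for all $i$ then $\sum s_i=\sum S_i$), and contains $(\beta)$ $(\lambda x.s)T=s\{T/x\}$ and $(\beta_D)$ $\mathsf{D}(\lambda x.s)\cdot t=\lambda x.\frac{\partial s}{\partial x}\cdot t$. Interpretation. For a sequence $\vec x=x_1,\dots,x_n$ of distinct variables let $U^{\vec x}=U^{x_1,\dots,x_{n-1}}\times U$ ($U^{\emptyset}$ terminal), with projections $\pi_n^{\vec x}=\pi_2$ and $\pi_i^{\vec x}=\pi_i^{x_1,\dots,x_{n-1}}\circ\pi_1$ for $i<n$. $\vec x$ is adequate for $S$ if $\mathrm{FV}(S)\subseteq\{x_1,\dots,x_n\}$. Then $[\![S]\!]_{\vec x}:U^{\vec x}\to U$ is: $[\![x_i]\!]=\pi_i^{\vec x}$; $[\![sT]\!]=\mathrm{ev}\circ\langle\mathcal{A}\circ[\![s]\!],[\![T]\!]\rangle$; $[\![\lambda z.s]\!]_{\vec x}=\lambda\circ\Lambda([\![s]\!]_{\vec x,z})$ ($z\notin\vec x$); $[\![\mathsf{D}^1s\cdot t]\!]=\lambda\circ\Lambda(\Lambda^-(\mathcal{A}\circ[\![s]\!])\star[\![t]\!])$; $[\![\mathsf{D}^{n+1}s\cdot(t_1,\dots,t_{n+1})]\!]=\lambda\circ\Lambda(\Lambda^-(\mathcal{A}\circ[\![\mathsf{D}^ns\cdot(t_1,\dots,t_n)]\!])\star[\![t_{n+1}]\!])$;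 $[\![0]\!]=0$; $[\![s+S]\!]=[\![s]\!]+[\![S]\!]$. $\mathrm{Th}(\mathscr{U})=\{S=T\mid [\![S]\!]_{\vec x}=[\![T]\!]_{\vec x}$ for some $\vec x$ adequate for $S,T\}$. -}

module Defs where

open import Level using (Level; _⊔_) renaming (suc to lsuc)
open import Data.Nat using (ℕ; zero; suc; _<_; _<ᵇ_; _≡ᵇ_; pred)
open import Data.Bool using (if_then_else_)
open import Data.List using (List; []; _∷_; _++_; map; concatMap; concat)
open import Data.List.Relation.Unary.All using (All)
open import Data.List.Relation.Binary.Pointwise using (Pointwise)
open import Data.List.Relation.Binary.Permutation.Propositional using (_↭_)
open import Data.Product using (Σ; _×_)
open import Relation.Binary using (Rel; IsEquivalence)

record CartesianCategoryWithSums (o ℓ e : Level) : Set (lsuc (o ⊔ ℓ ⊔ e)) where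
  infixr 9 _∘_
  infixl 6 _+_
  infix  4 _≈_
  infix  5 _⇒_
  infixr 7 _⊗_
  field
    Obj  : Set o
    _⇒_  : Obj → Obj → Set ℓ
    _≈_  : ∀ {A B} → Rel (A ⇒ B) e
    ≈-isEquivalence : ∀ {A B} → IsEquivalence (_≈_ {A} {B})
    id   : ∀ {A} → A ⇒ A
    _∘_  : ∀ {A B C} → B ⇒ C → A ⇒ B → A ⇒ C
    ∘-resp-≈  : ∀ {A B C} {f h : B ⇒ C} {g i : A ⇒ B} → f ≈ h → g ≈ i → f ∘ g ≈ h ∘ i
    identityˡ : ∀ {A B} {f : A ⇒ B} → id ∘ f ≈ f
    identityʳ : ∀ {A B} {f : A ⇒ B} → f ∘ id ≈ f
    assoc     : ∀ {A B C D} {f : A ⇒ B} {g : B ⇒ C} {h : C ⇒ D} → (h ∘ g) ∘ f ≈ h ∘ (g ∘ f)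
    _+_  : ∀ {A B} → A ⇒ B → A ⇒ B → A ⇒ B
    0m   : ∀ {A B} → A ⇒ B
    +-resp-≈    : ∀ {A B} {f g h i : A ⇒ B} → f ≈ g → h ≈ i → f + h ≈ g + i
    +-assoc     : ∀ {A B} (f g h : A ⇒ B) → (f + g) + h ≈ f + (g + h)
    +-comm      : ∀ {A B} (f g : A ⇒ B) → f + g ≈ g + f
    +-identityˡ : ∀ {A B} (f : A ⇒ B) → 0m + f ≈ f
    +-∘ : ∀ {A B C} (g h : B ⇒ C) (f : A ⇒ B) → (g + h) ∘ f ≈ g ∘ f + h ∘ f
    0-∘ : ∀ {A B C} (f : A ⇒ B) → 0m {B} {C} ∘ f ≈ 0m
    ⊤        : Obj
    !        : ∀ {A} → A ⇒ ⊤
    !-unique : ∀ {A} (f : A ⇒ ⊤) → f ≈ !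
    _⊗_   : Obj → Obj → Obj
    π₁    : ∀ {A B} → A ⊗ B ⇒ A
    π₂    : ∀ {A B} → A ⊗ B ⇒ B
    ⟨_,_⟩ : ∀ {A B C} → C ⇒ A → C ⇒ B → C ⇒ A ⊗ B
    π₁-⟨⟩ : ∀ {A B C} (f : C ⇒ A) (g : C ⇒ B) → π₁ ∘ ⟨ f , g ⟩ ≈ f
    π₂-⟨⟩ : ∀ {A B C} (f : C ⇒ A) (g : C ⇒ B) → π₂ ∘ ⟨ f , g ⟩ ≈ g
    ⟨⟩-unique : ∀ {A B C} {f : C ⇒ A} {g : C ⇒ B} {h : C ⇒ A ⊗ B} →
                π₁ ∘ h ≈ f → π₂ ∘ h ≈ g → h ≈ ⟨ f , g ⟩

  _×ₘ_ : ∀ {A B C D} → A ⇒ B → C ⇒ D → A ⊗ C ⇒ B ⊗ D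
  h ×ₘ k = ⟨ h ∘ π₁ , k ∘ π₂ ⟩

  IsAdditive : ∀ {A B} → A ⇒ B → Set (o ⊔ ℓ ⊔ e)
  IsAdditive {A} f = (∀ {X} (g h : X ⇒ A) → f ∘ (g + h) ≈ f ∘ g + f ∘ h)
                   × (∀ {X} → f ∘ 0m {X} ≈ 0m)

record CartesianLeftAdditiveCategory (o ℓ e : Level) : Set (lsuc (o ⊔ ℓ ⊔ e)) where
  field
    cat : CartesianCategoryWithSums o ℓ e
  open CartesianCategoryWithSums cat public
  field
    π₁-additive : ∀ {A B} → IsAdditive (π₁ {A} {B})
    π₂-additive : ∀ {A B} → IsAdditive (π₂ {A} {B})
    ⟨⟩-additive : ∀ {A B C} {f : C ⇒ A} {g : C ⇒ B} →
                  IsAdditive f → IsAdditive g → IsAdditive ⟨ f , g ⟩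

record CartesianDifferentialCategory (o ℓ e : Level) : Set (lsuc (o ⊔ ℓ ⊔ e)) where
  field
    clac : CartesianLeftAdditiveCategory o ℓ e
  open CartesianLeftAdditiveCategory clac public
  field
    D : ∀ {A B} → A ⇒ B → A ⊗ A ⇒ B
    D-resp-≈ : ∀ {A B} {f g : A ⇒ B} → f ≈ g → D f ≈ D g
    D1-+ : ∀ {A B} (f g : A ⇒ B) → D (f + g) ≈ D f + D g
    D1-0 : ∀ {A B} → D (0m {A} {B}) ≈ 0m
    D2-+ : ∀ {A B X} (f : A ⇒ B) (h k v : X ⇒ A) →
           D f ∘ ⟨ h + k , v ⟩ ≈ D f ∘ ⟨ h , v ⟩ + D f ∘ ⟨ k , v ⟩
    D2-0 : ∀ {A B X} (f : A ⇒ B) (v : X ⇒ A) → D f ∘ ⟨ 0m , v ⟩ ≈ 0m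
    D3-id : ∀ {A} → D (id {A}) ≈ π₁
    D3-π₁ : ∀ {A B} → D (π₁ {A} {B}) ≈ π₁ ∘ π₁
    D3-π₂ : ∀ {A B} → D (π₂ {A} {B}) ≈ π₂ ∘ π₁
    D4 : ∀ {A B C} (f : C ⇒ A) (g : C ⇒ B) → D ⟨ f , g ⟩ ≈ ⟨ D f , D g ⟩
    D5 : ∀ {A B C} (f : B ⇒ C) (g : A ⇒ B) → D (f ∘ g) ≈ D f ∘ ⟨ D g , g ∘ π₂ ⟩
    D6 : ∀ {A B X} (f : A ⇒ B) (g h k : X ⇒ A) →
         D (D f) ∘ ⟨ ⟨ g , 0m ⟩ , ⟨ h , k ⟩ ⟩ ≈ D f ∘ ⟨ g , k ⟩
    D7 : ∀ {A B X} (f : A ⇒ B) (g h k : X ⇒ A) →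
         D (D f) ∘ ⟨ ⟨ 0m , h ⟩ , ⟨ g , k ⟩ ⟩ ≈ D (D f) ∘ ⟨ ⟨ 0m , g ⟩ , ⟨ h , k ⟩ ⟩

  IsLinear : ∀ {A B} → A ⇒ B → Set e
  IsLinear f = D f ≈ f ∘ π₁

  _⋆_ : ∀ {A B C} → C ⊗ A ⇒ B → C ⇒ A → C ⊗ A ⇒ B
  f ⋆ g = D f ∘ ⟨ ⟨ 0m , g ∘ π₁ ⟩ , id ⟩

record CartesianClosedDifferentialCategory (o ℓ e : Level) : Set (lsuc (o ⊔ ℓ ⊔ e)) where
  field
    cdc : CartesianDifferentialCategory o ℓ e
  open CartesianDifferentialCategory cdc public
  field
    _⇨_ : Obj → Obj → Obj
    ev  : ∀ {A B} → (A ⇨ B) ⊗ A ⇒ B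
    Λ   : ∀ {A B C} → C ⊗ A ⇒ B → C ⇒ (A ⇨ B)
    Λ-resp-≈ : ∀ {A B C} {f g : C ⊗ A ⇒ B} → f ≈ g → Λ f ≈ Λ g
    exp-β : ∀ {A B C} (f : C ⊗ A ⇒ B) → ev ∘ (Λ f ×ₘ id) ≈ f
    exp-η : ∀ {A B C} (h : C ⇒ (A ⇨ B)) → Λ (ev ∘ (h ×ₘ id)) ≈ h
    Λ-+ : ∀ {A B C} (f g : C ⊗ A ⇒ B) → Λ (f + g) ≈ Λ f + Λ g
    Λ-0 : ∀ {A B C} → Λ (0m {C ⊗ A} {B}) ≈ 0m
    D-Λ : ∀ {A B C} (f : C ⊗ A ⇒ B) →
          D (Λ f) ≈ Λ (D f ∘ ⟨ π₁ ×ₘ 0m {A} {A} , π₂ ×ₘ id {A} ⟩)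

  Λ⁻ : ∀ {A B C} → C ⇒ (A ⇨ B) → C ⊗ A ⇒ B
  Λ⁻ h = ev ∘ (h ×ₘ id)

record LinearReflexiveObject {o ℓ e} (C : CartesianClosedDifferentialCategory o ℓ e)
       : Set (o ⊔ ℓ ⊔ e) where
  open CartesianClosedDifferentialCategory C
  field
    U     : Obj
    App   : U ⇒ (U ⇨ U)
    Lam   : (U ⇨ U) ⇒ U
    App∘Lam : App ∘ Lam ≈ id
    App-linear : IsLinear App
    Lam-linear : IsLinear Lam

-- Syntax of the differential λ-calculus (de Bruijn indices).
-- Simple terms s, t and differential terms S, T (finite sums = lists).

data STerm : Set where
  var : ℕ → STerm
  lam : STerm → STerm
  app : STerm → List STerm → STerm
  Dap : STerm → STerm → STerm

DTerm : Set
DTerm = List STerm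

lamS : DTerm → DTerm
lamS S = map lam S

appS : DTerm → DTerm → DTerm
appS S T = map (λ s → app s T) S

DS : DTerm → DTerm → DTerm
DS S T = concatMap (λ s → map (Dap s) T) S

shift : ℕ → STerm → STerm
shiftL : ℕ → List STerm → List STerm
shift c (var i) = if i <ᵇ c then var i else var (suc i)
shift c (lam s) = lam (shift (suc c) s)
shift c (app s T) = app (shift c s) (shiftL c T)
shift c (Dap s t) = Dap (shift c s) (shift c t)
shiftL c [] = []
shiftL c (s ∷ S) = shift c s ∷ shiftL c S

subst : ℕ → DTerm → STerm → DTerm
substL : ℕ → DTerm → List STerm → DTerm
subst k T (var i) =
  if i ≡ᵇ k then T else (if i <ᵇ k then var i ∷ [] else var (pred i) ∷ [])
subst k T (lam s) = lamS (subst (suc k) (shiftL 0 T) s)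
subst k T (app s U) = appS (subst k T s) (substL k T U)
subst k T (Dap s t) = DS (subst k T s) (subst k T t)
substL k T [] = []
substL k T (u ∷ U) = subst k T u ++ substL k T U

-- dsub k T s : differential substitution ∂s/∂x_k · T
dsub : ℕ → DTerm → STerm → DTerm
dsubL : ℕ → DTerm → List STerm → DTerm
dsub k T (var i) = if i ≡ᵇ k then T else []
dsub k T (lam s) = lamS (dsub (suc k) (shiftL 0 T) s)
dsub k T (app s U) = appS (dsub k T s) U ++ appS (DS (s ∷ []) (dsubL k T U)) U
dsub k T (Dap s u) = DS (dsub k T s) (u ∷ []) ++ DS (s ∷ []) (dsub k T u)
dsubL k T [] = []
dsubL k T (u ∷ U) = dsub k T u ++ dsubL k T U

Adequate : ℕ → STerm → Set
AdequateL : ℕ → List STerm → Set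
Adequate n (var i) = i < n
Adequate n (lam s) = Adequate (suc n) s
Adequate n (app s T) = Adequate n s × AdequateL n T
Adequate n (Dap s t) = Adequate n s × Adequate n t
AdequateL n [] = Data.Unit.⊤ where import Data.Unit
AdequateL n (s ∷ S) = Adequate n s × AdequateL n S

record IsDifferentialλTheory {r} (_≅_ : Rel DTerm r) : Set r where
  field
    isEquivalence : IsEquivalence _≅_
    -- syntactic identifications terms are taken up to
    sum-perm : ∀ {S T} → S ↭ T → S ≅ T
    D-perm   : ∀ s t u → (Dap (Dap s t) u ∷ []) ≅ (Dap (Dap s u) t ∷ [])
    compat-lam : ∀ {s S} → (s ∷ []) ≅ S → (lam s ∷ []) ≅ lamS S
    compat-app : ∀ {s S T U} → (s ∷ []) ≅ S → T ≅ U → (app s T ∷ []) ≅ appS S U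
    compat-D   : ∀ {s S u U} → (s ∷ []) ≅ S → (u ∷ []) ≅ U → (Dap s u ∷ []) ≅ DS S U
    compat-sum : ∀ {ss : List STerm} {SS : List DTerm} →
                 Pointwise (λ s S → (s ∷ []) ≅ S) ss SS → ss ≅ concat SS
    β  : ∀ s T → (app (lam s) T ∷ []) ≅ subst 0 T s
    βD : ∀ s t → (Dap (lam s) t ∷ []) ≅ lamS (dsub 0 (shift 0 t ∷ []) s)

module Interpretation {o ℓ e} {C : CartesianClosedDifferentialCategory o ℓ e}
                      (𝒰 : LinearReflexiveObject C) where
  open CartesianClosedDifferentialCategory C
  open LinearReflexiveObject 𝒰

  U^ : ℕ → Obj
  U^ zero = ⊤
  U^ (suc n) = U^ n ⊗ U

  -- de Bruijn index 0 is the last component (π₂); out-of-range → 0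
  ⟦var⟧ : ∀ n → ℕ → U^ n ⇒ U
  ⟦var⟧ zero i = 0m
  ⟦var⟧ (suc n) zero = π₂
  ⟦var⟧ (suc n) (suc i) = ⟦var⟧ n i ∘ π₁

  ⟦_⟧ : STerm → ∀ n → U^ n ⇒ U
  ⟦_⟧ₛ : DTerm → ∀ n → U^ n ⇒ U
  ⟦ var i ⟧ n = ⟦var⟧ n i
  ⟦ lam s ⟧ n = Lam ∘ Λ (⟦ s ⟧ (suc n))
  ⟦ app s T ⟧ n = ev ∘ ⟨ App ∘ ⟦ s ⟧ n , ⟦ T ⟧ₛ n ⟩
  ⟦ Dap s t ⟧ n = Lam ∘ Λ (Λ⁻ (App ∘ ⟦ s ⟧ n) ⋆ ⟦ t ⟧ n)
  ⟦ [] ⟧ₛ n = 0m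
  ⟦ s ∷ S ⟧ₛ n = ⟦ s ⟧ n + ⟦ S ⟧ₛ n

  Th : Rel DTerm e
  Th S T = Σ ℕ λ n → AdequateL n S × AdequateL n T × (⟦ S ⟧ₛ n ≈ ⟦ T ⟧ₛ n)

-- Each term former is interpreted by an operation on morphisms U^n ⇒ U (appᵐ, lamᵐ, Dapᵐ)
-- that is additive in every argument, because 𝒜 and λ are linear, and natural in the
-- context. Induction on terms then shows that substitution is composition with the
-- context morphism ⟨id, ⟦T⟧⟩, and that differential substitution is the directional
-- derivative D⟦s⟧ ∘ ⟨⟨0, ⟦T⟧⟩, id⟩; the cases of application and of D rest on a chain
-- rule for ev and on a Leibniz rule for ⋆. Together with 𝒜 ∘ λ = id and the
-- exponential β-law this yields (β) and (β_D), and (D7) gives the permutative equality.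
-- For adequate terms the interpretation is stable under enlarging the context, which
-- makes Th(𝒰) an equivalence relation and a congruence.

module Submission where

open import Level using (Level)
open import Data.Bool using (true; false; if_then_else_)
open import Data.List using (List; []; _∷_; _++_; map; concat)
open import Data.List.Relation.Binary.Pointwise using (Pointwise; []; _∷_)
open import Data.List.Relation.Binary.Permutation.Propositional using (_↭_; refl; prep; swap; trans)
open import Data.Nat using (ℕ; zero; suc; _<_; _≤_; _≤′_; ≤′-refl; ≤′-step; z≤n; s≤s; _≡ᵇ_; _<ᵇ_; pred; _⊔_)
open import Data.Nat.Properties using (≤-refl; <-≤-trans; n≤1+n; m≤m⊔n; m≤n⊔m; <⇒<ᵇ; ≤⇒≤′)
open import Data.Product using (Σ; _×_; _,_; proj₁; proj₂)
open import Data.Unit using (tt)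
open import Relation.Binary using (Setoid; IsEquivalence)
open import Relation.Binary.PropositionalEquality as ≡ using (_≡_)
import Relation.Binary.Reasoning.Setoid as SetoidReasoning

open import Defs

Adequate-mono : ∀ {n N} → n ≤ N → ∀ s → Adequate n s → Adequate N s
AdequateL-mono : ∀ {n N} → n ≤ N → ∀ S → AdequateL n S → AdequateL N S
Adequate-mono n≤N (var i) i<n = <-≤-trans i<n n≤N
Adequate-mono n≤N (lam s) a = Adequate-mono (s≤s n≤N) s a
Adequate-mono n≤N (app s T) (a , b) = Adequate-mono n≤N s a , AdequateL-mono n≤N T b
Adequate-mono n≤N (Dap s t) (a , b) = Adequate-mono n≤N s a , Adequate-mono n≤N t b
AdequateL-mono n≤N [] _ = tt
AdequateL-mono n≤N (s ∷ S) (a , b) = Adequate-mono n≤N s a , AdequateL-mono n≤N S b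

bound : STerm → ℕ
boundL : List STerm → ℕ
bound (var i) = suc i
bound (lam s) = bound s
bound (app s T) = bound s ⊔ boundL T
bound (Dap s t) = bound s ⊔ bound t
boundL [] = 0
boundL (s ∷ S) = bound s ⊔ boundL S

Adequate-bound : ∀ s → Adequate (bound s) s
AdequateL-bound : ∀ S → AdequateL (boundL S) S
Adequate-bound (var i) = ≤-refl
Adequate-bound (lam s) = Adequate-mono (n≤1+n _) s (Adequate-bound s)
Adequate-bound (app s T) =
  Adequate-mono (m≤m⊔n _ _) s (Adequate-bound s) , AdequateL-mono (m≤n⊔m _ _) T (AdequateL-bound T)
Adequate-bound (Dap s t) =
  Adequate-mono (m≤m⊔n _ _) s (Adequate-bound s) , Adequate-mono (m≤n⊔m _ _) t (Adequate-bound t)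
AdequateL-bound [] = tt
AdequateL-bound (s ∷ S) =
  Adequate-mono (m≤m⊔n _ _) s (Adequate-bound s) , AdequateL-mono (m≤n⊔m _ _) S (AdequateL-bound S)

shift-fresh : ∀ c s → Adequate c s → shift c s ≡ s
shiftL-fresh : ∀ c S → AdequateL c S → shiftL c S ≡ S
shift-fresh c (var i) i<c with i <ᵇ c | <⇒<ᵇ i<c
... | true | _ = ≡.refl
shift-fresh c (lam s) a = ≡.cong lam (shift-fresh (suc c) s a)
shift-fresh c (app s T) (a , b) = ≡.cong₂ app (shift-fresh c s a) (shiftL-fresh c T b)
shift-fresh c (Dap s t) (a , b) = ≡.cong₂ Dap (shift-fresh c s a) (shift-fresh c t b)
shiftL-fresh c [] _ = ≡.refl
shiftL-fresh c (s ∷ S) (a , b) = ≡.cong₂ _∷_ (shift-fresh c s a) (shiftL-fresh c S b)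

module _ {n : ℕ} where

  AdequateL-++ : ∀ S T → AdequateL n S → AdequateL n T → AdequateL n (S ++ T)
  AdequateL-++ [] T _ b = b
  AdequateL-++ (s ∷ S) T (a , a′) b = a , AdequateL-++ S T a′ b

  AdequateL-lamS : ∀ S → AdequateL (suc n) S → AdequateL n (lamS S)
  AdequateL-lamS [] _ = tt
  AdequateL-lamS (s ∷ S) (a , a′) = a , AdequateL-lamS S a′

  AdequateL-appS : ∀ S T → AdequateL n S → AdequateL n T → AdequateL n (appS S T)
  AdequateL-appS [] T _ _ = tt
  AdequateL-appS (s ∷ S) T (a , a′) b = (a , b) , AdequateL-appS S T a′ b

  AdequateL-map-Dap : ∀ s T → Adequate n s → AdequateL n T → AdequateL n (map (Dap s) T)
  AdequateL-map-Dap s [] _ _ = tt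
  AdequateL-map-Dap s (t ∷ T) a (b , b′) = (a , b) , AdequateL-map-Dap s T a b′

  AdequateL-DS : ∀ S T → AdequateL n S → AdequateL n T → AdequateL n (DS S T)
  AdequateL-DS [] T _ _ = tt
  AdequateL-DS (s ∷ S) T (a , a′) b =
    AdequateL-++ (map (Dap s) T) (DS S T) (AdequateL-map-Dap s T a b) (AdequateL-DS S T a′ b)

module HomReasoning {o ℓ e} (𝒞 : CartesianLeftAdditiveCategory o ℓ e) where
  open CartesianLeftAdditiveCategory 𝒞

  homSetoid : Obj → Obj → Setoid ℓ e
  homSetoid A B = record { Carrier = A ⇒ B ; _≈_ = _≈_ ; isEquivalence = ≈-isEquivalence }

  module _ {A B : Obj} where
    open IsEquivalence (≈-isEquivalence {A} {B}) public
      using () renaming (refl to ≈-refl; sym to ≈-sym; trans to ≈-trans)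
    open SetoidReasoning (homSetoid A B) public

  infixr 4 _⟩∘⟨_ refl⟩∘⟨_
  infixl 5 _⟩∘⟨refl
  infixr 5 _⟩+⟨_

  _⟩∘⟨_ : ∀ {A B C} {f h : B ⇒ C} {g i : A ⇒ B} → f ≈ h → g ≈ i → f ∘ g ≈ h ∘ i
  _⟩∘⟨_ = ∘-resp-≈

  refl⟩∘⟨_ : ∀ {A B C} {f : B ⇒ C} {g i : A ⇒ B} → g ≈ i → f ∘ g ≈ f ∘ i
  refl⟩∘⟨ p = ∘-resp-≈ ≈-refl p

  _⟩∘⟨refl : ∀ {A B C} {f h : B ⇒ C} {g : A ⇒ B} → f ≈ h → f ∘ g ≈ h ∘ g
  p ⟩∘⟨refl = ∘-resp-≈ p ≈-refl

  _⟩+⟨_ : ∀ {A B} {f g h i : A ⇒ B} → f ≈ g → h ≈ i → f + h ≈ g + i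
  _⟩+⟨_ = +-resp-≈

  sym-assoc : ∀ {A B C D} {f : A ⇒ B} {g : B ⇒ C} {h : C ⇒ D} → h ∘ (g ∘ f) ≈ (h ∘ g) ∘ f
  sym-assoc = ≈-sym assoc

  +-identityʳ : ∀ {A B} (f : A ⇒ B) → f + 0m ≈ f
  +-identityʳ f = ≈-trans (+-comm f 0m) (+-identityˡ f)

  0∘ : ∀ {A B C} {f : A ⇒ B} → 0m {B} {C} ∘ f ≈ 0m
  0∘ {f = f} = 0-∘ f

  π₁∘⟨⟩ : ∀ {A B X} {f : X ⇒ A} {g : X ⇒ B} → π₁ ∘ ⟨ f , g ⟩ ≈ f
  π₁∘⟨⟩ = π₁-⟨⟩ _ _

  π₂∘⟨⟩ : ∀ {A B X} {f : X ⇒ A} {g : X ⇒ B} → π₂ ∘ ⟨ f , g ⟩ ≈ g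
  π₂∘⟨⟩ = π₂-⟨⟩ _ _

  ⟨⟩-cong₂ : ∀ {A B X} {f f′ : X ⇒ A} {g g′ : X ⇒ B} → f ≈ f′ → g ≈ g′ → ⟨ f , g ⟩ ≈ ⟨ f′ , g′ ⟩
  ⟨⟩-cong₂ p q = ⟨⟩-unique (≈-trans π₁∘⟨⟩ p) (≈-trans π₂∘⟨⟩ q)

  ⟨⟩∘ : ∀ {A B X Y} {f : X ⇒ A} {g : X ⇒ B} {h : Y ⇒ X} → ⟨ f , g ⟩ ∘ h ≈ ⟨ f ∘ h , g ∘ h ⟩
  ⟨⟩∘ = ⟨⟩-unique (≈-trans sym-assoc (π₁∘⟨⟩ ⟩∘⟨refl)) (≈-trans sym-assoc (π₂∘⟨⟩ ⟩∘⟨refl))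

  ⟨π₁,π₂⟩ : ∀ {A B} → ⟨ π₁ , π₂ ⟩ ≈ id {A ⊗ B}
  ⟨π₁,π₂⟩ = ≈-sym (⟨⟩-unique identityʳ identityʳ)

  ×ₘ-cong₂ : ∀ {A B C D} {f f′ : A ⇒ B} {g g′ : C ⇒ D} → f ≈ f′ → g ≈ g′ → f ×ₘ g ≈ f′ ×ₘ g′
  ×ₘ-cong₂ p q = ⟨⟩-cong₂ (p ⟩∘⟨refl) (q ⟩∘⟨refl)

  ×ₘ∘⟨⟩ : ∀ {A B C D X} {f : A ⇒ B} {g : C ⇒ D} {h : X ⇒ A} {k : X ⇒ C} →
          (f ×ₘ g) ∘ ⟨ h , k ⟩ ≈ ⟨ f ∘ h , g ∘ k ⟩
  ×ₘ∘⟨⟩ = ≈-trans ⟨⟩∘ (⟨⟩-cong₂ (≈-trans assoc (refl⟩∘⟨ π₁∘⟨⟩)) (≈-trans assoc (refl⟩∘⟨ π₂∘⟨⟩)))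

  ×ₘ∘×ₘ : ∀ {A B C D A′ C′} {f : A ⇒ B} {g : C ⇒ D} {h : A′ ⇒ A} {k : C′ ⇒ C} →
          (f ×ₘ g) ∘ (h ×ₘ k) ≈ (f ∘ h) ×ₘ (g ∘ k)
  ×ₘ∘×ₘ = ≈-trans ×ₘ∘⟨⟩ (⟨⟩-cong₂ sym-assoc sym-assoc)

  id×ₘid : ∀ {A B} → id {A} ×ₘ id {B} ≈ id
  id×ₘid = ≈-trans (⟨⟩-cong₂ identityˡ identityˡ) ⟨π₁,π₂⟩

  ⟨⟩+⟨⟩ : ∀ {A B X} {f h : X ⇒ A} {g k : X ⇒ B} → ⟨ f , g ⟩ + ⟨ h , k ⟩ ≈ ⟨ f + h , g + k ⟩
  ⟨⟩+⟨⟩ = ⟨⟩-unique (≈-trans (proj₁ π₁-additive _ _) (π₁∘⟨⟩ ⟩+⟨ π₁∘⟨⟩))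
                    (≈-trans (proj₁ π₂-additive _ _) (π₂∘⟨⟩ ⟩+⟨ π₂∘⟨⟩))

  ⟨0,0⟩ : ∀ {A B X} → ⟨ 0m {X} {A} , 0m {X} {B} ⟩ ≈ 0m
  ⟨0,0⟩ = ≈-sym (⟨⟩-unique (proj₂ π₁-additive) (proj₂ π₂-additive))

  ⟨⟩-split : ∀ {A B X} {a : X ⇒ A} {b : X ⇒ B} → ⟨ a , b ⟩ ≈ ⟨ a , 0m ⟩ + ⟨ 0m , b ⟩
  ⟨⟩-split {a = a} {b} = ≈-sym (≈-trans ⟨⟩+⟨⟩ (⟨⟩-cong₂ (+-identityʳ a) (+-identityˡ b)))

  ⟨-,id⟩∘ : ∀ {A X Y} {f : A ⇒ X} {g : Y ⇒ A} → ⟨ f , id ⟩ ∘ g ≈ ⟨ f ∘ g , g ⟩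
  ⟨-,id⟩∘ = ≈-trans ⟨⟩∘ (⟨⟩-cong₂ ≈-refl identityˡ)

module DifferentialCalculus {o ℓ e} (𝒞 : CartesianDifferentialCategory o ℓ e) where
  open CartesianDifferentialCategory 𝒞
  open HomReasoning clac public

  ∂ : ∀ {A B} → A ⇒ B → A ⇒ A → A ⇒ B
  ∂ f v = D f ∘ ⟨ v , id ⟩

  D∘-at : ∀ {A B C X} (f : B ⇒ C) (g : A ⇒ B) (a p : X ⇒ A) →
          D (f ∘ g) ∘ ⟨ a , p ⟩ ≈ D f ∘ ⟨ D g ∘ ⟨ a , p ⟩ , g ∘ p ⟩
  D∘-at f g a p = ≈-trans (D5 f g ⟩∘⟨refl)
    (≈-trans assoc (refl⟩∘⟨ ≈-trans ⟨⟩∘ (⟨⟩-cong₂ ≈-refl (≈-trans assoc (refl⟩∘⟨ π₂∘⟨⟩)))))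

  D-id-at : ∀ {A X} (a p : X ⇒ A) → D id ∘ ⟨ a , p ⟩ ≈ a
  D-id-at a p = ≈-trans (D3-id ⟩∘⟨refl) π₁∘⟨⟩

  D-π₁-at : ∀ {A B X} (a p : X ⇒ A ⊗ B) → D π₁ ∘ ⟨ a , p ⟩ ≈ π₁ ∘ a
  D-π₁-at a p = ≈-trans (D3-π₁ ⟩∘⟨refl) (≈-trans assoc (refl⟩∘⟨ π₁∘⟨⟩))

  D-π₂-at : ∀ {A B X} (a p : X ⇒ A ⊗ B) → D π₂ ∘ ⟨ a , p ⟩ ≈ π₂ ∘ a
  D-π₂-at a p = ≈-trans (D3-π₂ ⟩∘⟨refl) (≈-trans assoc (refl⟩∘⟨ π₁∘⟨⟩))

  D∘π₁-at : ∀ {A B C X} (g : A ⇒ C) (a p : X ⇒ A ⊗ B) →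
            D (g ∘ π₁) ∘ ⟨ a , p ⟩ ≈ D g ∘ ⟨ π₁ ∘ a , π₁ ∘ p ⟩
  D∘π₁-at g a p = ≈-trans (D∘-at g π₁ a p) (refl⟩∘⟨ ⟨⟩-cong₂ (D-π₁-at a p) ≈-refl)

  D⟨⟩-at : ∀ {A B C X} (f : C ⇒ A) (g : C ⇒ B) (x : X ⇒ C ⊗ C) →
           D ⟨ f , g ⟩ ∘ x ≈ ⟨ D f ∘ x , D g ∘ x ⟩
  D⟨⟩-at f g x = ≈-trans (D4 f g ⟩∘⟨refl) ⟨⟩∘

  D0-at : ∀ {A B X} (x : X ⇒ A ⊗ A) → D (0m {A} {B}) ∘ x ≈ 0m
  D0-at x = ≈-trans (D1-0 ⟩∘⟨refl) 0∘

  D+-at : ∀ {A B X} (f g : A ⇒ B) (x : X ⇒ A ⊗ A) → D (f + g) ∘ x ≈ D f ∘ x + D g ∘ x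
  D+-at f g x = ≈-trans (D1-+ f g ⟩∘⟨refl) (+-∘ _ _ _)

  D-×ₘid-at : ∀ {A B C X} (h : A ⇒ B) (a : X ⇒ A) (b : X ⇒ C) (p : X ⇒ A ⊗ C) →
              D (h ×ₘ id) ∘ ⟨ ⟨ a , b ⟩ , p ⟩ ≈ ⟨ D h ∘ ⟨ a , π₁ ∘ p ⟩ , b ⟩
  D-×ₘid-at h a b p = ≈-trans (D⟨⟩-at _ _ _) (⟨⟩-cong₂
    (≈-trans (D∘π₁-at h _ p) (refl⟩∘⟨ ⟨⟩-cong₂ π₁∘⟨⟩ ≈-refl))
    (≈-trans (D∘-at id π₂ _ p) (≈-trans (D-id-at _ _) (≈-trans (D-π₂-at _ p) π₂∘⟨⟩))))

  linear-at : ∀ {A B X} {f : A ⇒ B} → IsLinear f → (a p : X ⇒ A) → D f ∘ ⟨ a , p ⟩ ≈ f ∘ a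
  linear-at lin a p = ≈-trans (lin ⟩∘⟨refl) (≈-trans assoc (refl⟩∘⟨ π₁∘⟨⟩))

  linear-+ : ∀ {A B X} {f : A ⇒ B} → IsLinear f → (g h : X ⇒ A) → f ∘ (g + h) ≈ f ∘ g + f ∘ h
  linear-+ {f = f} lin g h = begin
    f ∘ (g + h)                        ≈⟨ linear-at lin (g + h) g ⟨
    D f ∘ ⟨ g + h , g ⟩                ≈⟨ D2-+ f g h g ⟩
    D f ∘ ⟨ g , g ⟩ + D f ∘ ⟨ h , g ⟩  ≈⟨ linear-at lin g g ⟩+⟨ linear-at lin h g ⟩
    f ∘ g + f ∘ h                      ∎

  linear-0 : ∀ {A B X} {f : A ⇒ B} → IsLinear f → f ∘ 0m {X} ≈ 0m
  linear-0 {f = f} lin = ≈-trans (≈-sym (linear-at lin 0m 0m)) (D2-0 f 0m)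

  ∂-linear∘ : ∀ {A B C} {f : B ⇒ C} → IsLinear f → (g : A ⇒ B) (v : A ⇒ A) → ∂ (f ∘ g) v ≈ f ∘ ∂ g v
  ∂-linear∘ lin g v = ≈-trans (D∘-at _ g v id) (linear-at lin _ _)

  ⋆-cong₂ : ∀ {A B X} {F F′ : X ⊗ A ⇒ B} {g g′ : X ⇒ A} → F ≈ F′ → g ≈ g′ → F ⋆ g ≈ F′ ⋆ g′
  ⋆-cong₂ p q = D-resp-≈ p ⟩∘⟨ ⟨⟩-cong₂ (⟨⟩-cong₂ ≈-refl (q ⟩∘⟨refl)) ≈-refl

  ⋆-+ˡ : ∀ {A B X} (F G : X ⊗ A ⇒ B) (g : X ⇒ A) → (F + G) ⋆ g ≈ F ⋆ g + G ⋆ g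
  ⋆-+ˡ F G g = D+-at F G _

  ⋆-0ˡ : ∀ {A B X} (g : X ⇒ A) → (0m {X ⊗ A} {B}) ⋆ g ≈ 0m
  ⋆-0ˡ g = D0-at _

  ⋆-+ʳ : ∀ {A B X} (F : X ⊗ A ⇒ B) (g h : X ⇒ A) → F ⋆ (g + h) ≈ F ⋆ g + F ⋆ h
  ⋆-+ʳ F g h = ≈-trans (refl⟩∘⟨ ⟨⟩-cong₂ direction ≈-refl) (D2-+ F _ _ _)
    where
    direction : ⟨ 0m , (g + h) ∘ π₁ ⟩ ≈ ⟨ 0m , g ∘ π₁ ⟩ + ⟨ 0m , h ∘ π₁ ⟩
    direction = ≈-trans (⟨⟩-cong₂ (≈-sym (+-identityʳ 0m)) (+-∘ g h π₁)) (≈-sym ⟨⟩+⟨⟩)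

  ⋆-0ʳ : ∀ {A B X} (F : X ⊗ A ⇒ B) → F ⋆ 0m ≈ 0m
  ⋆-0ʳ F = ≈-trans (refl⟩∘⟨ ⟨⟩-cong₂ (≈-trans (⟨⟩-cong₂ ≈-refl 0∘) ⟨0,0⟩) ≈-refl) (D2-0 F _)

  ⋆-natural : ∀ {A B X Y} (F : X ⊗ A ⇒ B) (g : X ⇒ A) (ρ : Y ⇒ X) →
              (F ⋆ g) ∘ (ρ ×ₘ id) ≈ (F ∘ (ρ ×ₘ id)) ⋆ (g ∘ ρ)
  ⋆-natural F g ρ = begin
    (D F ∘ ⟨ ⟨ 0m , g ∘ π₁ ⟩ , id ⟩) ∘ (ρ ×ₘ id)              ≈⟨ assoc ⟩
    D F ∘ (⟨ ⟨ 0m , g ∘ π₁ ⟩ , id ⟩ ∘ (ρ ×ₘ id))              ≈⟨ refl⟩∘⟨ ≈-trans ⟨-,id⟩∘ (⟨⟩-cong₂ direction (≈-sym identityʳ)) ⟩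
    D F ∘ ⟨ D (ρ ×ₘ id) ∘ ⟨ ⟨ 0m , (g ∘ ρ) ∘ π₁ ⟩ , id ⟩ , (ρ ×ₘ id) ∘ id ⟩
                                                               ≈⟨ D∘-at F (ρ ×ₘ id) _ id ⟨
    D (F ∘ (ρ ×ₘ id)) ∘ ⟨ ⟨ 0m , (g ∘ ρ) ∘ π₁ ⟩ , id ⟩       ∎
    where
    moved : (g ∘ π₁) ∘ (ρ ×ₘ id) ≈ (g ∘ ρ) ∘ π₁
    moved = ≈-trans assoc (≈-trans (refl⟩∘⟨ π₁∘⟨⟩) sym-assoc)
    direction : ⟨ 0m , g ∘ π₁ ⟩ ∘ (ρ ×ₘ id) ≈ D (ρ ×ₘ id) ∘ ⟨ ⟨ 0m , (g ∘ ρ) ∘ π₁ ⟩ , id ⟩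
    direction = ≈-trans ⟨⟩∘ (≈-trans (⟨⟩-cong₂ 0∘ moved)
      (≈-sym (≈-trans (D-×ₘid-at ρ 0m _ id) (⟨⟩-cong₂ (D2-0 ρ _) ≈-refl))))

  ∂-⋆-expand : ∀ {A B X} (F : X ⊗ A ⇒ B) (g : X ⇒ A) (p : X ⊗ A ⇒ X) (q : X ⊗ A ⇒ A) →
               ∂ (F ⋆ g) ⟨ p , q ⟩ ≈
               D (D F) ∘ ⟨ ⟨ ⟨ 0m , D g ∘ ⟨ p , π₁ ⟩ ⟩ , ⟨ p , q ⟩ ⟩ , ⟨ ⟨ 0m , g ∘ π₁ ⟩ , id ⟩ ⟩
  ∂-⋆-expand F g p q = ≈-trans (D∘-at (D F) _ _ id) (refl⟩∘⟨ ⟨⟩-cong₂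
    (≈-trans (D⟨⟩-at _ _ _) (⟨⟩-cong₂
      (≈-trans (D⟨⟩-at _ _ _) (⟨⟩-cong₂ (D0-at _)
        (≈-trans (D∘π₁-at g _ id) (refl⟩∘⟨ ⟨⟩-cong₂ π₁∘⟨⟩ identityʳ))))
      (D-id-at _ id)))
    identityʳ)

  ⋆-⋆ : ∀ {A B X} (F : X ⊗ A ⇒ B) (t u : X ⇒ A) →
        (F ⋆ t) ⋆ u ≈ D (D F) ∘ ⟨ ⟨ 0m , ⟨ 0m , u ∘ π₁ ⟩ ⟩ , ⟨ ⟨ 0m , t ∘ π₁ ⟩ , id ⟩ ⟩
  ⋆-⋆ F t u = ≈-trans (∂-⋆-expand F t 0m (u ∘ π₁))
    (refl⟩∘⟨ ⟨⟩-cong₂ (⟨⟩-cong₂ (≈-trans (⟨⟩-cong₂ ≈-refl (D2-0 t _)) ⟨0,0⟩) ≈-refl) ≈-refl)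

  ⋆-⋆-exchange : ∀ {A B X} (F : X ⊗ A ⇒ B) (t u : X ⇒ A) → (F ⋆ t) ⋆ u ≈ (F ⋆ u) ⋆ t
  ⋆-⋆-exchange F t u = ≈-trans (⋆-⋆ F t u) (≈-trans (D7 F _ _ _) (≈-sym (⋆-⋆ F u t)))

  -- (D6) reduces one half of D (D F) to a first derivative; (D7) swaps the directions of the other half.
  ∂-⋆ : ∀ {A B X} (F : X ⊗ A ⇒ B) (g : X ⇒ A) (v : X ⇒ X) →
        ∂ (F ⋆ g) ⟨ v ∘ π₁ , 0m ⟩ ≈ ∂ F ⟨ v ∘ π₁ , 0m ⟩ ⋆ g + F ⋆ ∂ g v
  ∂-⋆ F g v = begin
    ∂ (F ⋆ g) H                                                 ≈⟨ ∂-⋆-expand F g (v ∘ π₁) 0m ⟩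
    D (D F) ∘ ⟨ ⟨ ⟨ 0m , g′ ⟩ , H ⟩ , P ⟩                        ≈⟨ refl⟩∘⟨ ⟨⟩-cong₂ ⟨⟩-split ≈-refl ⟩
    D (D F) ∘ ⟨ ⟨ ⟨ 0m , g′ ⟩ , 0m ⟩ + ⟨ 0m , H ⟩ , P ⟩         ≈⟨ D2-+ (D F) _ _ _ ⟩
    D (D F) ∘ ⟨ ⟨ ⟨ 0m , g′ ⟩ , 0m ⟩ , P ⟩ + D (D F) ∘ ⟨ ⟨ 0m , H ⟩ , P ⟩
                                                                 ≈⟨ D6 F _ _ _ ⟩+⟨ D7 F _ _ _ ⟩
    D F ∘ ⟨ ⟨ 0m , g′ ⟩ , id ⟩ + D (D F) ∘ ⟨ ⟨ 0m , ⟨ 0m , g ∘ π₁ ⟩ ⟩ , ⟨ H , id ⟩ ⟩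
                                                                 ≈⟨ first-order ⟩+⟨ ≈-sym mixed ⟩
    F ⋆ ∂ g v + ∂ F H ⋆ g                                        ≈⟨ +-comm _ _ ⟩
    ∂ F H ⋆ g + F ⋆ ∂ g v                                        ∎
    where
    H = ⟨ v ∘ π₁ , 0m ⟩
    g′ = D g ∘ ⟨ v ∘ π₁ , π₁ ⟩
    P = ⟨ ⟨ 0m , g ∘ π₁ ⟩ , id ⟩
    first-order : D F ∘ ⟨ ⟨ 0m , g′ ⟩ , id ⟩ ≈ F ⋆ ∂ g v
    first-order = refl⟩∘⟨ ⟨⟩-cong₂ (⟨⟩-cong₂ ≈-refl (≈-trans (refl⟩∘⟨ ≈-sym ⟨-,id⟩∘) sym-assoc)) ≈-refl
    H-constant : D H ∘ P ≈ 0m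
    H-constant = ≈-trans (D⟨⟩-at _ _ _) (≈-trans (⟨⟩-cong₂
      (≈-trans (D∘π₁-at v _ _) (≈-trans (refl⟩∘⟨ ⟨⟩-cong₂ π₁∘⟨⟩ ≈-refl) (D2-0 v _)))
      (D0-at _)) ⟨0,0⟩)
    mixed : ∂ F H ⋆ g ≈ D (D F) ∘ ⟨ ⟨ 0m , ⟨ 0m , g ∘ π₁ ⟩ ⟩ , ⟨ H , id ⟩ ⟩
    mixed = ≈-trans (D∘-at (D F) ⟨ H , id ⟩ _ id) (refl⟩∘⟨ ⟨⟩-cong₂
      (≈-trans (D⟨⟩-at _ _ _) (⟨⟩-cong₂ H-constant (D-id-at _ id)))
      identityʳ)

module ClosedDifferentialCalculus {o ℓ e} (𝒞 : CartesianClosedDifferentialCategory o ℓ e) where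
  open CartesianClosedDifferentialCategory 𝒞
  open DifferentialCalculus cdc public

  Λ-natural : ∀ {A B X Y} {f : X ⊗ A ⇒ B} {h : Y ⇒ X} → Λ f ∘ h ≈ Λ (f ∘ (h ×ₘ id))
  Λ-natural {f = f} {h} = begin
    Λ f ∘ h                              ≈⟨ exp-η (Λ f ∘ h) ⟨
    Λ (ev ∘ ((Λ f ∘ h) ×ₘ id))           ≈⟨ Λ-resp-≈ (refl⟩∘⟨ ≈-trans ×ₘ∘×ₘ (×ₘ-cong₂ ≈-refl identityˡ)) ⟨
    Λ (ev ∘ ((Λ f ×ₘ id) ∘ (h ×ₘ id)))   ≈⟨ Λ-resp-≈ (≈-trans sym-assoc (exp-β f ⟩∘⟨refl)) ⟩
    Λ (f ∘ (h ×ₘ id))                    ∎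

  ev-Λ : ∀ {A B X Y} {f : X ⊗ A ⇒ B} {h : Y ⇒ X} {k : Y ⇒ A} → ev ∘ ⟨ Λ f ∘ h , k ⟩ ≈ f ∘ ⟨ h , k ⟩
  ev-Λ {f = f} {h} {k} = begin
    ev ∘ ⟨ Λ f ∘ h , k ⟩            ≈⟨ refl⟩∘⟨ ≈-trans ×ₘ∘⟨⟩ (⟨⟩-cong₂ ≈-refl identityˡ) ⟨
    ev ∘ ((Λ f ×ₘ id) ∘ ⟨ h , k ⟩)  ≈⟨ ≈-trans sym-assoc (exp-β f ⟩∘⟨refl) ⟩
    f ∘ ⟨ h , k ⟩                   ∎

  ev-Λ-id : ∀ {A B X} {f : X ⊗ A ⇒ B} {k : X ⇒ A} → ev ∘ ⟨ Λ f , k ⟩ ≈ f ∘ ⟨ id , k ⟩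
  ev-Λ-id = ≈-trans (refl⟩∘⟨ ⟨⟩-cong₂ (≈-sym identityʳ) ≈-refl) ev-Λ

  ev-+ˡ : ∀ {A B X} (f g : X ⇒ (A ⇨ B)) (h : X ⇒ A) → ev ∘ ⟨ f + g , h ⟩ ≈ ev ∘ ⟨ f , h ⟩ + ev ∘ ⟨ g , h ⟩
  ev-+ˡ f g h = begin
    ev ∘ ⟨ f + g , h ⟩                            ≈⟨ refl⟩∘⟨ ⟨⟩-cong₂ uncurried ≈-refl ⟩
    ev ∘ ⟨ Λ (Λ⁻ f + Λ⁻ g) , h ⟩                  ≈⟨ ev-Λ-id ⟩
    (Λ⁻ f + Λ⁻ g) ∘ ⟨ id , h ⟩                    ≈⟨ +-∘ _ _ _ ⟩
    Λ⁻ f ∘ ⟨ id , h ⟩ + Λ⁻ g ∘ ⟨ id , h ⟩         ≈⟨ ev-Λ-id ⟩+⟨ ev-Λ-id ⟨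
    ev ∘ ⟨ Λ (Λ⁻ f) , h ⟩ + ev ∘ ⟨ Λ (Λ⁻ g) , h ⟩ ≈⟨ (refl⟩∘⟨ ⟨⟩-cong₂ (exp-η f) ≈-refl) ⟩+⟨
                                                     (refl⟩∘⟨ ⟨⟩-cong₂ (exp-η g) ≈-refl) ⟩
    ev ∘ ⟨ f , h ⟩ + ev ∘ ⟨ g , h ⟩               ∎
    where
    uncurried : f + g ≈ Λ (Λ⁻ f + Λ⁻ g)
    uncurried = ≈-trans (≈-sym (exp-η f) ⟩+⟨ ≈-sym (exp-η g)) (≈-sym (Λ-+ _ _))

  ev-0ˡ : ∀ {A B X} (h : X ⇒ A) → ev {A} {B} ∘ ⟨ 0m , h ⟩ ≈ 0m
  ev-0ˡ h = ≈-trans (refl⟩∘⟨ ⟨⟩-cong₂ (≈-sym Λ-0) ≈-refl) (≈-trans ev-Λ-id 0∘)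

  Λ⁻-cong : ∀ {A B X} {h h′ : X ⇒ (A ⇨ B)} → h ≈ h′ → Λ⁻ h ≈ Λ⁻ h′
  Λ⁻-cong p = refl⟩∘⟨ ×ₘ-cong₂ p ≈-refl

  Λ⁻-+ : ∀ {A B X} (a b : X ⇒ (A ⇨ B)) → Λ⁻ (a + b) ≈ Λ⁻ a + Λ⁻ b
  Λ⁻-+ a b = ≈-trans (refl⟩∘⟨ ⟨⟩-cong₂ (+-∘ a b π₁) ≈-refl) (ev-+ˡ _ _ _)

  Λ⁻-0 : ∀ {A B X} → Λ⁻ (0m {X} {A ⇨ B}) ≈ 0m
  Λ⁻-0 = ≈-trans (refl⟩∘⟨ ⟨⟩-cong₂ 0∘ ≈-refl) (ev-0ˡ _)

  Λ⁻-natural : ∀ {A B X Y} (h : X ⇒ (A ⇨ B)) (ρ : Y ⇒ X) → Λ⁻ h ∘ (ρ ×ₘ id) ≈ Λ⁻ (h ∘ ρ)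
  Λ⁻-natural h ρ = ≈-trans assoc (refl⟩∘⟨ ≈-trans ×ₘ∘×ₘ (×ₘ-cong₂ ≈-refl identityˡ))

  Λ-ev : ∀ {A B} → Λ (ev {A} {B}) ≈ id
  Λ-ev = ≈-trans (Λ-resp-≈ (≈-sym (≈-trans (refl⟩∘⟨ id×ₘid) identityʳ))) (exp-η id)

  -- (D-Λ) applied to Λ ev = id says that ev is linear in its function argument.
  D-ev-along-function : ∀ {A B X} (a h : X ⇒ (A ⇨ B)) (x : X ⇒ A) →
                        D ev ∘ ⟨ ⟨ a , 0m ⟩ , ⟨ h , x ⟩ ⟩ ≈ ev ∘ ⟨ a , x ⟩
  D-ev-along-function a h x = begin
    D ev ∘ ⟨ ⟨ a , 0m ⟩ , ⟨ h , x ⟩ ⟩                       ≈⟨ refl⟩∘⟨ rearranged ⟨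
    D ev ∘ (⟨ π₁ ×ₘ 0m , π₂ ×ₘ id ⟩ ∘ ⟨ ⟨ a , h ⟩ , x ⟩)   ≈⟨ sym-assoc ⟩
    (D ev ∘ ⟨ π₁ ×ₘ 0m , π₂ ×ₘ id ⟩) ∘ ⟨ ⟨ a , h ⟩ , x ⟩   ≈⟨ ev-linear ⟩∘⟨refl ⟩
    (ev ∘ (π₁ ×ₘ id)) ∘ ⟨ ⟨ a , h ⟩ , x ⟩                   ≈⟨ ≈-trans assoc (refl⟩∘⟨ ≈-trans ×ₘ∘⟨⟩ (⟨⟩-cong₂ π₁∘⟨⟩ identityˡ)) ⟩
    ev ∘ ⟨ a , x ⟩                                          ∎
    where
    rearranged : ⟨ π₁ ×ₘ 0m , π₂ ×ₘ id ⟩ ∘ ⟨ ⟨ a , h ⟩ , x ⟩ ≈ ⟨ ⟨ a , 0m ⟩ , ⟨ h , x ⟩ ⟩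
    rearranged = ≈-trans ⟨⟩∘ (⟨⟩-cong₂ (≈-trans ×ₘ∘⟨⟩ (⟨⟩-cong₂ π₁∘⟨⟩ 0∘))
                                       (≈-trans ×ₘ∘⟨⟩ (⟨⟩-cong₂ π₂∘⟨⟩ identityˡ)))
    ev-linear : D ev ∘ ⟨ π₁ ×ₘ 0m , π₂ ×ₘ id ⟩ ≈ ev ∘ (π₁ ×ₘ id)
    ev-linear = begin
      D ev ∘ ⟨ π₁ ×ₘ 0m , π₂ ×ₘ id ⟩                  ≈⟨ exp-β _ ⟨
      ev ∘ (Λ (D ev ∘ ⟨ π₁ ×ₘ 0m , π₂ ×ₘ id ⟩) ×ₘ id) ≈⟨ refl⟩∘⟨ ×ₘ-cong₂ (D-Λ ev) ≈-refl ⟨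
      ev ∘ (D (Λ ev) ×ₘ id)                            ≈⟨ refl⟩∘⟨ ×ₘ-cong₂ (≈-trans (D-resp-≈ Λ-ev) D3-id) ≈-refl ⟩
      ev ∘ (π₁ ×ₘ id)                                  ∎

  D-ev-along-argument : ∀ {A B X} (h : X ⇒ (A ⇨ B)) (b x : X ⇒ A) →
                        D ev ∘ ⟨ ⟨ 0m , b ⟩ , ⟨ h , x ⟩ ⟩ ≈ (Λ⁻ h ⋆ b) ∘ ⟨ id , x ⟩
  D-ev-along-argument h b x = ≈-sym (begin
    (D (ev ∘ (h ×ₘ id)) ∘ ⟨ ⟨ 0m , b ∘ π₁ ⟩ , id ⟩) ∘ ⟨ id , x ⟩   ≈⟨ ≈-trans assoc (refl⟩∘⟨ ≈-trans ⟨-,id⟩∘ (⟨⟩-cong₂ direction ≈-refl)) ⟩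
    D (ev ∘ (h ×ₘ id)) ∘ ⟨ ⟨ 0m , b ⟩ , ⟨ id , x ⟩ ⟩              ≈⟨ D∘-at ev (h ×ₘ id) _ _ ⟩
    D ev ∘ ⟨ D (h ×ₘ id) ∘ ⟨ ⟨ 0m , b ⟩ , ⟨ id , x ⟩ ⟩ , (h ×ₘ id) ∘ ⟨ id , x ⟩ ⟩
                                                                   ≈⟨ refl⟩∘⟨ ⟨⟩-cong₂
                                                                        (≈-trans (D-×ₘid-at h 0m b _) (⟨⟩-cong₂ (D2-0 h _) ≈-refl))
                                                                        (≈-trans ×ₘ∘⟨⟩ (⟨⟩-cong₂ identityʳ identityˡ)) ⟩
    D ev ∘ ⟨ ⟨ 0m , b ⟩ , ⟨ h , x ⟩ ⟩                              ∎)
    where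
    direction : ⟨ 0m , b ∘ π₁ ⟩ ∘ ⟨ id , x ⟩ ≈ ⟨ 0m , b ⟩
    direction = ≈-trans ⟨⟩∘ (⟨⟩-cong₂ 0∘ (≈-trans assoc (≈-trans (refl⟩∘⟨ π₁∘⟨⟩) identityʳ)))

  ∂-Λ : ∀ {A B X} (f : X ⊗ A ⇒ B) (v : X ⇒ X) → ∂ (Λ f) v ≈ Λ (∂ f ⟨ v ∘ π₁ , 0m ⟩)
  ∂-Λ f v = begin
    D (Λ f) ∘ ⟨ v , id ⟩                                              ≈⟨ D-Λ f ⟩∘⟨refl ⟩
    Λ (D f ∘ ⟨ π₁ ×ₘ 0m , π₂ ×ₘ id ⟩) ∘ ⟨ v , id ⟩                   ≈⟨ Λ-natural ⟩
    Λ ((D f ∘ ⟨ π₁ ×ₘ 0m , π₂ ×ₘ id ⟩) ∘ (⟨ v , id ⟩ ×ₘ id))         ≈⟨ Λ-resp-≈ (≈-trans assoc (refl⟩∘⟨ direction)) ⟩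
    Λ (D f ∘ ⟨ ⟨ v ∘ π₁ , 0m ⟩ , id ⟩)                               ∎
    where
    direction : ⟨ π₁ ×ₘ 0m , π₂ ×ₘ id ⟩ ∘ (⟨ v , id ⟩ ×ₘ id) ≈ ⟨ ⟨ v ∘ π₁ , 0m ⟩ , id ⟩
    direction = ≈-trans ⟨⟩∘ (⟨⟩-cong₂
      (≈-trans ×ₘ∘×ₘ (⟨⟩-cong₂ (π₁∘⟨⟩ ⟩∘⟨refl) (≈-trans (identityʳ ⟩∘⟨refl) 0∘)))
      (≈-trans ×ₘ∘×ₘ (≈-trans (×ₘ-cong₂ π₂∘⟨⟩ identityˡ) id×ₘid)))

  ∂-ev : ∀ {A B X} (a : X ⇒ (A ⇨ B)) (g : X ⇒ A) (v : X ⇒ X) →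
         ∂ (ev ∘ ⟨ a , g ⟩) v ≈ ev ∘ ⟨ ∂ a v , g ⟩ + (Λ⁻ a ⋆ ∂ g v) ∘ ⟨ id , g ⟩
  ∂-ev a g v = begin
    D (ev ∘ ⟨ a , g ⟩) ∘ ⟨ v , id ⟩                               ≈⟨ D∘-at ev _ v id ⟩
    D ev ∘ ⟨ D ⟨ a , g ⟩ ∘ ⟨ v , id ⟩ , ⟨ a , g ⟩ ∘ id ⟩          ≈⟨ refl⟩∘⟨ ⟨⟩-cong₂ (≈-trans (D⟨⟩-at _ _ _) ⟨⟩-split) identityʳ ⟩
    D ev ∘ ⟨ ⟨ ∂ a v , 0m ⟩ + ⟨ 0m , ∂ g v ⟩ , ⟨ a , g ⟩ ⟩          ≈⟨ D2-+ ev _ _ _ ⟩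
    D ev ∘ ⟨ ⟨ ∂ a v , 0m ⟩ , ⟨ a , g ⟩ ⟩ + D ev ∘ ⟨ ⟨ 0m , ∂ g v ⟩ , ⟨ a , g ⟩ ⟩
                                                                   ≈⟨ D-ev-along-function _ a g ⟩+⟨ D-ev-along-argument a _ g ⟩
    ev ∘ ⟨ ∂ a v , g ⟩ + (Λ⁻ a ⋆ ∂ g v) ∘ ⟨ id , g ⟩               ∎

  Λ⁻-∂ : ∀ {A B X} (h : X ⇒ (A ⇨ B)) (v : X ⇒ X) → Λ⁻ (∂ h v) ≈ ∂ (Λ⁻ h) ⟨ v ∘ π₁ , 0m ⟩
  Λ⁻-∂ h v = ≈-sym (begin
    D (ev ∘ (h ×ₘ id)) ∘ ⟨ ⟨ v ∘ π₁ , 0m ⟩ , id ⟩                    ≈⟨ D∘-at ev _ _ id ⟩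
    D ev ∘ ⟨ D (h ×ₘ id) ∘ ⟨ ⟨ v ∘ π₁ , 0m ⟩ , id ⟩ , (h ×ₘ id) ∘ id ⟩
                                                                     ≈⟨ refl⟩∘⟨ ⟨⟩-cong₂ (D-×ₘid-at _ _ _ id) identityʳ ⟩
    D ev ∘ ⟨ ⟨ D h ∘ ⟨ v ∘ π₁ , π₁ ∘ id ⟩ , 0m ⟩ , h ×ₘ id ⟩         ≈⟨ D-ev-along-function _ _ _ ⟩
    ev ∘ ⟨ D h ∘ ⟨ v ∘ π₁ , π₁ ∘ id ⟩ , id ∘ π₂ ⟩                    ≈⟨ refl⟩∘⟨ ⟨⟩-cong₂ moved ≈-refl ⟩
    ev ∘ ⟨ ∂ h v ∘ π₁ , id ∘ π₂ ⟩                                    ∎)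
    where
    moved : D h ∘ ⟨ v ∘ π₁ , π₁ ∘ id ⟩ ≈ ∂ h v ∘ π₁
    moved = ≈-trans (refl⟩∘⟨ ≈-trans (⟨⟩-cong₂ ≈-refl identityʳ) (≈-sym ⟨-,id⟩∘)) sym-assoc

module ReflexiveModel {o ℓ e} {𝒞 : CartesianClosedDifferentialCategory o ℓ e}
                      (𝒰 : LinearReflexiveObject 𝒞) where
  open CartesianClosedDifferentialCategory 𝒞
  open LinearReflexiveObject 𝒰
  open ClosedDifferentialCalculus 𝒞 public

  App∘Lam∘ : ∀ {X} {h : X ⇒ (U ⇨ U)} → App ∘ (Lam ∘ h) ≈ h
  App∘Lam∘ = ≈-trans sym-assoc (≈-trans (App∘Lam ⟩∘⟨refl) identityˡ)

  appᵐ : ∀ {X} → X ⇒ U → X ⇒ U → X ⇒ U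
  appᵐ f g = ev ∘ ⟨ App ∘ f , g ⟩

  lamᵐ : ∀ {X} → X ⊗ U ⇒ U → X ⇒ U
  lamᵐ f = Lam ∘ Λ f

  Dapᵐ : ∀ {X} → X ⇒ U → X ⇒ U → X ⇒ U
  Dapᵐ f g = lamᵐ (Λ⁻ (App ∘ f) ⋆ g)

  appᵐ-cong₂ : ∀ {X} {f f′ g g′ : X ⇒ U} → f ≈ f′ → g ≈ g′ → appᵐ f g ≈ appᵐ f′ g′
  appᵐ-cong₂ p q = refl⟩∘⟨ ⟨⟩-cong₂ (refl⟩∘⟨ p) q

  lamᵐ-cong : ∀ {X} {f f′ : X ⊗ U ⇒ U} → f ≈ f′ → lamᵐ f ≈ lamᵐ f′
  lamᵐ-cong p = refl⟩∘⟨ Λ-resp-≈ p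

  Dapᵐ-cong₂ : ∀ {X} {f f′ g g′ : X ⇒ U} → f ≈ f′ → g ≈ g′ → Dapᵐ f g ≈ Dapᵐ f′ g′
  Dapᵐ-cong₂ p q = lamᵐ-cong (⋆-cong₂ (Λ⁻-cong (refl⟩∘⟨ p)) q)

  appᵐ-+ˡ : ∀ {X} (f g h : X ⇒ U) → appᵐ (f + g) h ≈ appᵐ f h + appᵐ g h
  appᵐ-+ˡ f g h = ≈-trans (refl⟩∘⟨ ⟨⟩-cong₂ (linear-+ App-linear f g) ≈-refl) (ev-+ˡ _ _ _)

  appᵐ-0ˡ : ∀ {X} (h : X ⇒ U) → appᵐ 0m h ≈ 0m
  appᵐ-0ˡ h = ≈-trans (refl⟩∘⟨ ⟨⟩-cong₂ (linear-0 App-linear) ≈-refl) (ev-0ˡ _)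

  lamᵐ-+ : ∀ {X} (f g : X ⊗ U ⇒ U) → lamᵐ (f + g) ≈ lamᵐ f + lamᵐ g
  lamᵐ-+ f g = ≈-trans (refl⟩∘⟨ Λ-+ f g) (linear-+ Lam-linear _ _)

  lamᵐ-0 : ∀ {X} → lamᵐ (0m {X ⊗ U} {U}) ≈ 0m
  lamᵐ-0 = ≈-trans (refl⟩∘⟨ Λ-0) (linear-0 Lam-linear)

  Dapᵐ-+ˡ : ∀ {X} (f g h : X ⇒ U) → Dapᵐ (f + g) h ≈ Dapᵐ f h + Dapᵐ g h
  Dapᵐ-+ˡ f g h = ≈-trans (lamᵐ-cong (≈-trans (⋆-cong₂ uncurried ≈-refl) (⋆-+ˡ _ _ _))) (lamᵐ-+ _ _)
    where
    uncurried : Λ⁻ (App ∘ (f + g)) ≈ Λ⁻ (App ∘ f) + Λ⁻ (App ∘ g)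
    uncurried = ≈-trans (Λ⁻-cong (linear-+ App-linear f g)) (Λ⁻-+ _ _)

  Dapᵐ-0ˡ : ∀ {X} (h : X ⇒ U) → Dapᵐ 0m h ≈ 0m
  Dapᵐ-0ˡ h = ≈-trans (lamᵐ-cong (≈-trans (⋆-cong₂ uncurried ≈-refl) (⋆-0ˡ h))) lamᵐ-0
    where
    uncurried : Λ⁻ (App ∘ 0m) ≈ 0m
    uncurried = ≈-trans (Λ⁻-cong (linear-0 App-linear)) Λ⁻-0

  Dapᵐ-+ʳ : ∀ {X} (f g h : X ⇒ U) → Dapᵐ f (g + h) ≈ Dapᵐ f g + Dapᵐ f h
  Dapᵐ-+ʳ f g h = ≈-trans (lamᵐ-cong (⋆-+ʳ _ g h)) (lamᵐ-+ _ _)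

  Dapᵐ-0ʳ : ∀ {X} (f : X ⇒ U) → Dapᵐ f 0m ≈ 0m
  Dapᵐ-0ʳ f = ≈-trans (lamᵐ-cong (⋆-0ʳ _)) lamᵐ-0

  appᵐ-natural : ∀ {X Y} (f g : X ⇒ U) (ρ : Y ⇒ X) → appᵐ f g ∘ ρ ≈ appᵐ (f ∘ ρ) (g ∘ ρ)
  appᵐ-natural f g ρ = ≈-trans assoc (refl⟩∘⟨ ≈-trans ⟨⟩∘ (⟨⟩-cong₂ assoc ≈-refl))

  lamᵐ-natural : ∀ {X Y} (f : X ⊗ U ⇒ U) (ρ : Y ⇒ X) → lamᵐ f ∘ ρ ≈ lamᵐ (f ∘ (ρ ×ₘ id))
  lamᵐ-natural f ρ = ≈-trans assoc (refl⟩∘⟨ Λ-natural)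

  Dapᵐ-natural : ∀ {X Y} (f g : X ⇒ U) (ρ : Y ⇒ X) → Dapᵐ f g ∘ ρ ≈ Dapᵐ (f ∘ ρ) (g ∘ ρ)
  Dapᵐ-natural f g ρ = ≈-trans (lamᵐ-natural _ ρ)
    (lamᵐ-cong (≈-trans (⋆-natural _ g ρ) (⋆-cong₂ (≈-trans (Λ⁻-natural _ ρ) (Λ⁻-cong assoc)) ≈-refl)))

  appᵐ-lamᵐ : ∀ {X} (f : X ⊗ U ⇒ U) (g : X ⇒ U) → appᵐ (lamᵐ f) g ≈ f ∘ ⟨ id , g ⟩
  appᵐ-lamᵐ f g = ≈-trans (refl⟩∘⟨ ⟨⟩-cong₂ App∘Lam∘ ≈-refl) ev-Λ-id

  Dapᵐ-lamᵐ : ∀ {X} (f : X ⊗ U ⇒ U) (g : X ⇒ U) → Dapᵐ (lamᵐ f) g ≈ lamᵐ (f ⋆ g)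
  Dapᵐ-lamᵐ f g = lamᵐ-cong (⋆-cong₂ (≈-trans (Λ⁻-cong App∘Lam∘) (exp-β f)) ≈-refl)

  Dapᵐ-exchange : ∀ {X} (f t u : X ⇒ U) → Dapᵐ (Dapᵐ f t) u ≈ Dapᵐ (Dapᵐ f u) t
  Dapᵐ-exchange f t u = begin
    Dapᵐ (Dapᵐ f t) u               ≈⟨ Dapᵐ-lamᵐ _ u ⟩
    lamᵐ ((Λ⁻ (App ∘ f) ⋆ t) ⋆ u)   ≈⟨ lamᵐ-cong (⋆-⋆-exchange _ t u) ⟩
    lamᵐ ((Λ⁻ (App ∘ f) ⋆ u) ⋆ t)   ≈⟨ Dapᵐ-lamᵐ _ t ⟨
    Dapᵐ (Dapᵐ f u) t               ∎

  ∂-lamᵐ : ∀ {X} (f : X ⊗ U ⇒ U) (v : X ⇒ X) → ∂ (lamᵐ f) v ≈ lamᵐ (∂ f ⟨ v ∘ π₁ , 0m ⟩)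
  ∂-lamᵐ f v = ≈-trans (∂-linear∘ Lam-linear (Λ f) v) (refl⟩∘⟨ ∂-Λ f v)

  ∂-appᵐ : ∀ {X} (f g : X ⇒ U) (v : X ⇒ X) →
           ∂ (appᵐ f g) v ≈ appᵐ (∂ f v) g + appᵐ (Dapᵐ f (∂ g v)) g
  ∂-appᵐ f g v = begin
    ∂ (appᵐ f g) v                                                       ≈⟨ ∂-ev (App ∘ f) g v ⟩
    ev ∘ ⟨ ∂ (App ∘ f) v , g ⟩ + (Λ⁻ (App ∘ f) ⋆ ∂ g v) ∘ ⟨ id , g ⟩    ≈⟨ (refl⟩∘⟨ ⟨⟩-cong₂ (∂-linear∘ App-linear f v) ≈-refl) ⟩+⟨
                                                                              ≈-sym (appᵐ-lamᵐ _ g) ⟩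
    appᵐ (∂ f v) g + appᵐ (Dapᵐ f (∂ g v)) g                             ∎

  ∂-Dapᵐ : ∀ {X} (f g : X ⇒ U) (v : X ⇒ X) →
           ∂ (Dapᵐ f g) v ≈ Dapᵐ (∂ f v) g + Dapᵐ f (∂ g v)
  ∂-Dapᵐ f g v = begin
    ∂ (Dapᵐ f g) v                                           ≈⟨ ∂-lamᵐ _ v ⟩
    lamᵐ (∂ (F ⋆ g) ⟨ v ∘ π₁ , 0m ⟩)                          ≈⟨ lamᵐ-cong (∂-⋆ F g v) ⟩
    lamᵐ (∂ F ⟨ v ∘ π₁ , 0m ⟩ ⋆ g + F ⋆ ∂ g v)               ≈⟨ lamᵐ-cong (⋆-cong₂ derivative-uncurried ≈-refl ⟩+⟨ ≈-refl) ⟩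
    lamᵐ (Λ⁻ (App ∘ ∂ f v) ⋆ g + F ⋆ ∂ g v)                  ≈⟨ lamᵐ-+ _ _ ⟩
    Dapᵐ (∂ f v) g + Dapᵐ f (∂ g v)                          ∎
    where
    F = Λ⁻ (App ∘ f)
    derivative-uncurried : ∂ F ⟨ v ∘ π₁ , 0m ⟩ ≈ Λ⁻ (App ∘ ∂ f v)
    derivative-uncurried = ≈-trans (≈-sym (Λ⁻-∂ (App ∘ f) v)) (Λ⁻-cong (∂-linear∘ App-linear f v))

module Soundness {o ℓ e} {𝒞 : CartesianClosedDifferentialCategory o ℓ e}
                 (𝒰 : LinearReflexiveObject 𝒞) where
  open CartesianClosedDifferentialCategory 𝒞
  open LinearReflexiveObject 𝒰
  open Interpretation 𝒰
  open ReflexiveModel 𝒰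

  ⟦++⟧ : ∀ S T n → ⟦ S ++ T ⟧ₛ n ≈ ⟦ S ⟧ₛ n + ⟦ T ⟧ₛ n
  ⟦++⟧ [] T n = ≈-sym (+-identityˡ _)
  ⟦++⟧ (s ∷ S) T n = ≈-trans (≈-refl ⟩+⟨ ⟦++⟧ S T n) (≈-sym (+-assoc _ _ _))

  ⟦[_]⟧ : ∀ s n → ⟦ s ∷ [] ⟧ₛ n ≈ ⟦ s ⟧ n
  ⟦[ s ]⟧ n = +-identityʳ _

  ⟦lamS⟧ : ∀ S n → ⟦ lamS S ⟧ₛ n ≈ lamᵐ (⟦ S ⟧ₛ (suc n))
  ⟦lamS⟧ [] n = ≈-sym lamᵐ-0
  ⟦lamS⟧ (s ∷ S) n = ≈-trans (≈-refl ⟩+⟨ ⟦lamS⟧ S n) (≈-sym (lamᵐ-+ _ _))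

  ⟦appS⟧ : ∀ S T n → ⟦ appS S T ⟧ₛ n ≈ appᵐ (⟦ S ⟧ₛ n) (⟦ T ⟧ₛ n)
  ⟦appS⟧ [] T n = ≈-sym (appᵐ-0ˡ _)
  ⟦appS⟧ (s ∷ S) T n = ≈-trans (≈-refl ⟩+⟨ ⟦appS⟧ S T n) (≈-sym (appᵐ-+ˡ _ _ _))

  ⟦map-Dap⟧ : ∀ s T n → ⟦ map (Dap s) T ⟧ₛ n ≈ Dapᵐ (⟦ s ⟧ n) (⟦ T ⟧ₛ n)
  ⟦map-Dap⟧ s [] n = ≈-sym (Dapᵐ-0ʳ _)
  ⟦map-Dap⟧ s (t ∷ T) n = ≈-trans (≈-refl ⟩+⟨ ⟦map-Dap⟧ s T n) (≈-sym (Dapᵐ-+ʳ _ _ _))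

  ⟦DS⟧ : ∀ S T n → ⟦ DS S T ⟧ₛ n ≈ Dapᵐ (⟦ S ⟧ₛ n) (⟦ T ⟧ₛ n)
  ⟦DS⟧ [] T n = ≈-sym (Dapᵐ-0ˡ _)
  ⟦DS⟧ (s ∷ S) T n = begin
    ⟦ map (Dap s) T ++ DS S T ⟧ₛ n                         ≈⟨ ⟦++⟧ (map (Dap s) T) (DS S T) n ⟩
    ⟦ map (Dap s) T ⟧ₛ n + ⟦ DS S T ⟧ₛ n                    ≈⟨ ⟦map-Dap⟧ s T n ⟩+⟨ ⟦DS⟧ S T n ⟩
    Dapᵐ (⟦ s ⟧ n) (⟦ T ⟧ₛ n) + Dapᵐ (⟦ S ⟧ₛ n) (⟦ T ⟧ₛ n)  ≈⟨ Dapᵐ-+ˡ _ _ _ ⟨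
    Dapᵐ (⟦ s ∷ S ⟧ₛ n) (⟦ T ⟧ₛ n)                          ∎

  ⟦↭⟧ : ∀ {S T} → S ↭ T → ∀ n → ⟦ S ⟧ₛ n ≈ ⟦ T ⟧ₛ n
  ⟦↭⟧ refl n = ≈-refl
  ⟦↭⟧ (prep x p) n = ≈-refl ⟩+⟨ ⟦↭⟧ p n
  ⟦↭⟧ (swap x y p) n =
    ≈-trans (≈-sym (+-assoc _ _ _)) (≈-trans (+-comm _ _ ⟩+⟨ ⟦↭⟧ p n) (+-assoc _ _ _))
  ⟦↭⟧ (trans p q) n = ≈-trans (⟦↭⟧ p n) (⟦↭⟧ q n)

  ⟦var⟧-linear : ∀ m i → IsLinear (⟦var⟧ m i)
  ⟦var⟧-linear zero i = ≈-trans D1-0 (≈-sym 0∘)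
  ⟦var⟧-linear (suc m) zero = D3-π₂
  ⟦var⟧-linear (suc m) (suc i) = begin
    D (⟦var⟧ m i ∘ π₁)                      ≈⟨ D5 _ _ ⟩
    D (⟦var⟧ m i) ∘ ⟨ D π₁ , π₁ ∘ π₂ ⟩      ≈⟨ ⟦var⟧-linear m i ⟩∘⟨ ⟨⟩-cong₂ D3-π₁ ≈-refl ⟩
    (⟦var⟧ m i ∘ π₁) ∘ ⟨ π₁ ∘ π₁ , π₁ ∘ π₂ ⟩ ≈⟨ ≈-trans assoc (≈-trans (refl⟩∘⟨ π₁∘⟨⟩) sym-assoc) ⟩
    (⟦var⟧ m i ∘ π₁) ∘ π₁                   ∎

  omitAt : ℕ → (m : ℕ) → U^ (suc m) ⇒ U^ m
  omitAt zero m = π₁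
  omitAt (suc c) zero = π₁
  omitAt (suc c) (suc m) = omitAt c m ×ₘ id

  ∘π₁-under-×ₘid : ∀ {A B C Y} {x : B ⇒ Y} {v : A ⇒ Y} {d : B ⇒ A} →
                   x ≈ v ∘ d → x ∘ π₁ ≈ (v ∘ π₁) ∘ (d ×ₘ id {C})
  ∘π₁-under-×ₘid x≈v∘d =
    ≈-trans (x≈v∘d ⟩∘⟨refl) (≈-trans assoc (≈-trans (refl⟩∘⟨ ≈-sym π₁∘⟨⟩) sym-assoc))

  ⟦shift-var⟧ : ∀ c m i → c ≤ m → ⟦ shift c (var i) ⟧ (suc m) ≈ ⟦var⟧ m i ∘ omitAt c m
  ⟦shift-var⟧ zero m i _ = ≈-refl
  ⟦shift-var⟧ (suc c) (suc m) zero _ = ≈-sym (≈-trans π₂∘⟨⟩ identityˡ)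
  ⟦shift-var⟧ (suc c) (suc m) (suc i) (s≤s c≤m) with i <ᵇ c | ⟦shift-var⟧ c m i c≤m
  ... | true  | ih = ∘π₁-under-×ₘid ih
  ... | false | ih = ∘π₁-under-×ₘid ih

  -- Only c ≤ m is meaningful: beyond the context, variables denote the junk value 0.
  ⟦shift⟧ : ∀ c m → c ≤ m → ∀ s → ⟦ shift c s ⟧ (suc m) ≈ ⟦ s ⟧ m ∘ omitAt c m
  ⟦shiftL⟧ : ∀ c m → c ≤ m → ∀ S → ⟦ shiftL c S ⟧ₛ (suc m) ≈ ⟦ S ⟧ₛ m ∘ omitAt c m
  ⟦shift⟧ c m c≤m (var i) = ⟦shift-var⟧ c m i c≤m
  ⟦shift⟧ c m c≤m (lam s) =
    ≈-trans (lamᵐ-cong (⟦shift⟧ (suc c) (suc m) (s≤s c≤m) s)) (≈-sym (lamᵐ-natural _ _))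
  ⟦shift⟧ c m c≤m (app s T) =
    ≈-trans (appᵐ-cong₂ (⟦shift⟧ c m c≤m s) (⟦shiftL⟧ c m c≤m T)) (≈-sym (appᵐ-natural _ _ _))
  ⟦shift⟧ c m c≤m (Dap s t) =
    ≈-trans (Dapᵐ-cong₂ (⟦shift⟧ c m c≤m s) (⟦shift⟧ c m c≤m t)) (≈-sym (Dapᵐ-natural _ _ _))
  ⟦shiftL⟧ c m c≤m [] = ≈-sym 0∘
  ⟦shiftL⟧ c m c≤m (s ∷ S) =
    ≈-trans (⟦shift⟧ c m c≤m s ⟩+⟨ ⟦shiftL⟧ c m c≤m S) (≈-sym (+-∘ _ _ _))

  insertAt : ∀ {X} (k m : ℕ) → X ⇒ U^ m → X ⇒ U → X ⇒ U^ (suc m)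
  insertAt zero m ρ g = ⟨ ρ , g ⟩
  insertAt (suc k) zero ρ g = ⟨ ρ , g ⟩
  insertAt (suc k) (suc m) ρ g = ⟨ insertAt k m (π₁ ∘ ρ) g , π₂ ∘ ρ ⟩

  insertAt-cong₂ : ∀ {X} k m {ρ ρ′ : X ⇒ U^ m} {g g′ : X ⇒ U} →
                   ρ ≈ ρ′ → g ≈ g′ → insertAt k m ρ g ≈ insertAt k m ρ′ g′
  insertAt-cong₂ zero m p q = ⟨⟩-cong₂ p q
  insertAt-cong₂ (suc k) zero p q = ⟨⟩-cong₂ p q
  insertAt-cong₂ (suc k) (suc m) p q = ⟨⟩-cong₂ (insertAt-cong₂ k m (refl⟩∘⟨ p) q) (refl⟩∘⟨ p)

  insertAt-natural : ∀ {X Y} k m (ρ : X ⇒ U^ m) (g : X ⇒ U) (h : Y ⇒ X) →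
                     insertAt k m ρ g ∘ h ≈ insertAt k m (ρ ∘ h) (g ∘ h)
  insertAt-natural zero m ρ g h = ⟨⟩∘
  insertAt-natural (suc k) zero ρ g h = ⟨⟩∘
  insertAt-natural (suc k) (suc m) ρ g h =
    ≈-trans ⟨⟩∘ (⟨⟩-cong₂ (≈-trans (insertAt-natural k m _ g h) (insertAt-cong₂ k m assoc ≈-refl)) assoc)

  substitutedVar : ∀ {X} (k m i : ℕ) → X ⇒ U^ m → X ⇒ U → X ⇒ U
  substitutedVar k m i ρ g =
    if i ≡ᵇ k then g else (if i <ᵇ k then ⟦var⟧ m i ∘ ρ else ⟦var⟧ m (pred i) ∘ ρ)

  substitutedVar-suc : ∀ {X} i k m (ρ : X ⇒ U^ (suc m)) g →
                       substitutedVar k m i (π₁ ∘ ρ) g ≈ substitutedVar (suc k) (suc m) (suc i) ρ g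
  substitutedVar-suc zero zero m ρ g = ≈-refl
  substitutedVar-suc zero (suc k) m ρ g = sym-assoc
  substitutedVar-suc (suc i) k m ρ g with suc i ≡ᵇ k | suc i <ᵇ k
  ... | true  | _     = ≈-refl
  ... | false | true  = sym-assoc
  ... | false | false = sym-assoc

  ⟦var⟧∘insertAt : ∀ {X} k m i → k ≤ m → (ρ : X ⇒ U^ m) (g : X ⇒ U) →
                   ⟦var⟧ (suc m) i ∘ insertAt k m ρ g ≈ substitutedVar k m i ρ g
  ⟦var⟧∘insertAt zero m zero _ ρ g = π₂∘⟨⟩
  ⟦var⟧∘insertAt zero m (suc i) _ ρ g = ≈-trans assoc (refl⟩∘⟨ π₁∘⟨⟩)
  ⟦var⟧∘insertAt (suc k) (suc m) zero _ ρ g = π₂∘⟨⟩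
  ⟦var⟧∘insertAt (suc k) (suc m) (suc i) (s≤s k≤m) ρ g =
    ≈-trans assoc (≈-trans (refl⟩∘⟨ π₁∘⟨⟩)
      (≈-trans (⟦var⟧∘insertAt k m i k≤m (π₁ ∘ ρ) g) (substitutedVar-suc i k m ρ g)))

  ⟦subst-var⟧ : ∀ k m i T → ⟦ subst k T (var i) ⟧ₛ m ≈ substitutedVar k m i id (⟦ T ⟧ₛ m)
  ⟦subst-var⟧ k m i T with i ≡ᵇ k | i <ᵇ k
  ... | true  | _     = ≈-refl
  ... | false | true  = ≈-trans (+-identityʳ _) (≈-sym identityʳ)
  ... | false | false = ≈-trans (+-identityʳ _) (≈-sym identityʳ)

  ⟦subst⟧ : ∀ k m → k ≤ m → ∀ T s → ⟦ subst k T s ⟧ₛ m ≈ ⟦ s ⟧ (suc m) ∘ insertAt k m id (⟦ T ⟧ₛ m)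
  ⟦substL⟧ : ∀ k m → k ≤ m → ∀ T S → ⟦ substL k T S ⟧ₛ m ≈ ⟦ S ⟧ₛ (suc m) ∘ insertAt k m id (⟦ T ⟧ₛ m)
  ⟦subst⟧ k m k≤m T (var i) = ≈-trans (⟦subst-var⟧ k m i T) (≈-sym (⟦var⟧∘insertAt k m i k≤m id _))
  ⟦subst⟧ k m k≤m T (lam s) = begin
    ⟦ lamS (subst (suc k) T′ s) ⟧ₛ m                                   ≈⟨ ⟦lamS⟧ (subst (suc k) T′ s) m ⟩
    lamᵐ (⟦ subst (suc k) T′ s ⟧ₛ (suc m))                             ≈⟨ lamᵐ-cong (⟦subst⟧ (suc k) (suc m) (s≤s k≤m) T′ s) ⟩
    lamᵐ (⟦ s ⟧ (suc (suc m)) ∘ insertAt (suc k) (suc m) id (⟦ T′ ⟧ₛ (suc m)))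
                                                                       ≈⟨ lamᵐ-cong (refl⟩∘⟨ ⟨⟩-cong₂ weakened (≈-trans identityʳ (≈-sym identityˡ))) ⟩
    lamᵐ (⟦ s ⟧ (suc (suc m)) ∘ (insertAt k m id (⟦ T ⟧ₛ m) ×ₘ id))   ≈⟨ lamᵐ-natural _ _ ⟨
    lamᵐ (⟦ s ⟧ (suc (suc m))) ∘ insertAt k m id (⟦ T ⟧ₛ m)           ∎
    where
    T′ = shiftL 0 T
    weakened : insertAt k m (π₁ ∘ id) (⟦ T′ ⟧ₛ (suc m)) ≈ insertAt k m id (⟦ T ⟧ₛ m) ∘ π₁
    weakened = ≈-trans (insertAt-cong₂ k m (≈-trans identityʳ (≈-sym identityˡ)) (⟦shiftL⟧ 0 m z≤n T))
                       (≈-sym (insertAt-natural k m id _ π₁))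
  ⟦subst⟧ k m k≤m T (app s V) = ≈-trans (⟦appS⟧ (subst k T s) (substL k T V) m)
    (≈-trans (appᵐ-cong₂ (⟦subst⟧ k m k≤m T s) (⟦substL⟧ k m k≤m T V)) (≈-sym (appᵐ-natural _ _ _)))
  ⟦subst⟧ k m k≤m T (Dap s t) = ≈-trans (⟦DS⟧ (subst k T s) (subst k T t) m)
    (≈-trans (Dapᵐ-cong₂ (⟦subst⟧ k m k≤m T s) (⟦subst⟧ k m k≤m T t)) (≈-sym (Dapᵐ-natural _ _ _)))
  ⟦substL⟧ k m k≤m T [] = ≈-sym 0∘
  ⟦substL⟧ k m k≤m T (u ∷ S) = ≈-trans (⟦++⟧ (subst k T u) (substL k T S) m)
    (≈-trans (⟦subst⟧ k m k≤m T u ⟩+⟨ ⟦substL⟧ k m k≤m T S) (≈-sym (+-∘ _ _ _)))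

  injectAt : ∀ {X} (k m : ℕ) → X ⇒ U → X ⇒ U^ m
  injectAt k zero g = 0m
  injectAt zero (suc m) g = ⟨ 0m , g ⟩
  injectAt (suc k) (suc m) g = ⟨ injectAt k m g , 0m ⟩

  injectAt-cong : ∀ {X} k m {g g′ : X ⇒ U} → g ≈ g′ → injectAt k m g ≈ injectAt k m g′
  injectAt-cong k zero p = ≈-refl
  injectAt-cong zero (suc m) p = ⟨⟩-cong₂ ≈-refl p
  injectAt-cong (suc k) (suc m) p = ⟨⟩-cong₂ (injectAt-cong k m p) ≈-refl

  injectAt-natural : ∀ {X Y} k m (g : X ⇒ U) (h : Y ⇒ X) → injectAt k m g ∘ h ≈ injectAt k m (g ∘ h)
  injectAt-natural k zero g h = 0∘
  injectAt-natural zero (suc m) g h = ≈-trans ⟨⟩∘ (⟨⟩-cong₂ 0∘ ≈-refl)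
  injectAt-natural (suc k) (suc m) g h = ≈-trans ⟨⟩∘ (⟨⟩-cong₂ (injectAt-natural k m g h) 0∘)

  ⟦var⟧∘injectAt : ∀ {X} k m i → k < m → (g : X ⇒ U) →
                   ⟦var⟧ m i ∘ injectAt k m g ≈ (if i ≡ᵇ k then g else 0m)
  ⟦var⟧∘injectAt zero (suc m) zero _ g = π₂∘⟨⟩
  ⟦var⟧∘injectAt zero (suc m) (suc i) _ g =
    ≈-trans assoc (≈-trans (refl⟩∘⟨ π₁∘⟨⟩) (linear-0 (⟦var⟧-linear m i)))
  ⟦var⟧∘injectAt (suc k) (suc m) zero _ g = π₂∘⟨⟩
  ⟦var⟧∘injectAt (suc k) (suc m) (suc i) (s≤s k<m) g =
    ≈-trans assoc (≈-trans (refl⟩∘⟨ π₁∘⟨⟩) (⟦var⟧∘injectAt k m i k<m g))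

  ⟦dsub-var⟧ : ∀ k m i T → ⟦ dsub k T (var i) ⟧ₛ m ≈ (if i ≡ᵇ k then ⟦ T ⟧ₛ m else 0m)
  ⟦dsub-var⟧ k m i T with i ≡ᵇ k
  ... | true  = ≈-refl
  ... | false = ≈-refl

  ⟦dsub⟧ : ∀ k m → k < m → ∀ T s → ⟦ dsub k T s ⟧ₛ m ≈ ∂ (⟦ s ⟧ m) (injectAt k m (⟦ T ⟧ₛ m))
  ⟦dsubL⟧ : ∀ k m → k < m → ∀ T S → ⟦ dsubL k T S ⟧ₛ m ≈ ∂ (⟦ S ⟧ₛ m) (injectAt k m (⟦ T ⟧ₛ m))
  ⟦dsub⟧ k m k<m T (var i) = ≈-trans (⟦dsub-var⟧ k m i T)
    (≈-sym (≈-trans (linear-at (⟦var⟧-linear m i) _ _) (⟦var⟧∘injectAt k m i k<m _)))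
  ⟦dsub⟧ k m k<m T (lam s) = begin
    ⟦ lamS (dsub (suc k) T′ s) ⟧ₛ m                                    ≈⟨ ⟦lamS⟧ (dsub (suc k) T′ s) m ⟩
    lamᵐ (⟦ dsub (suc k) T′ s ⟧ₛ (suc m))                              ≈⟨ lamᵐ-cong (⟦dsub⟧ (suc k) (suc m) (s≤s k<m) T′ s) ⟩
    lamᵐ (∂ (⟦ s ⟧ (suc m)) ⟨ injectAt k m (⟦ T′ ⟧ₛ (suc m)) , 0m ⟩)  ≈⟨ lamᵐ-cong (refl⟩∘⟨ ⟨⟩-cong₂ (⟨⟩-cong₂ weakened ≈-refl) ≈-refl) ⟩
    lamᵐ (∂ (⟦ s ⟧ (suc m)) ⟨ injectAt k m (⟦ T ⟧ₛ m) ∘ π₁ , 0m ⟩)    ≈⟨ ∂-lamᵐ _ _ ⟨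
    ∂ (lamᵐ (⟦ s ⟧ (suc m))) (injectAt k m (⟦ T ⟧ₛ m))               ∎
    where
    T′ = shiftL 0 T
    weakened : injectAt k m (⟦ T′ ⟧ₛ (suc m)) ≈ injectAt k m (⟦ T ⟧ₛ m) ∘ π₁
    weakened = ≈-trans (injectAt-cong k m (⟦shiftL⟧ 0 m z≤n T)) (≈-sym (injectAt-natural k m _ π₁))
  ⟦dsub⟧ k m k<m T (app s V) = begin
    ⟦ appS (dsub k T s) V ++ appS (DS (s ∷ []) (dsubL k T V)) V ⟧ₛ m
                                        ≈⟨ ⟦++⟧ (appS (dsub k T s) V) (appS (DS (s ∷ []) (dsubL k T V)) V) m ⟩
    ⟦ appS (dsub k T s) V ⟧ₛ m + ⟦ appS (DS (s ∷ []) (dsubL k T V)) V ⟧ₛ m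
                                        ≈⟨ ⟦appS⟧ (dsub k T s) V m ⟩+⟨ ⟦appS⟧ (DS (s ∷ []) (dsubL k T V)) V m ⟩
    appᵐ (⟦ dsub k T s ⟧ₛ m) (⟦ V ⟧ₛ m) + appᵐ (⟦ DS (s ∷ []) (dsubL k T V) ⟧ₛ m) (⟦ V ⟧ₛ m)
                                        ≈⟨ appᵐ-cong₂ (⟦dsub⟧ k m k<m T s) ≈-refl ⟩+⟨
                                           appᵐ-cong₂ (≈-trans (⟦DS⟧ (s ∷ []) (dsubL k T V) m)
                                                        (Dapᵐ-cong₂ (⟦[ s ]⟧ m) (⟦dsubL⟧ k m k<m T V))) ≈-refl ⟩
    appᵐ (∂ (⟦ s ⟧ m) v) (⟦ V ⟧ₛ m) + appᵐ (Dapᵐ (⟦ s ⟧ m) (∂ (⟦ V ⟧ₛ m) v)) (⟦ V ⟧ₛ m)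
                                        ≈⟨ ∂-appᵐ _ _ v ⟨
    ∂ (⟦ app s V ⟧ m) v                 ∎
    where v = injectAt k m (⟦ T ⟧ₛ m)
  ⟦dsub⟧ k m k<m T (Dap s u) = begin
    ⟦ DS (dsub k T s) (u ∷ []) ++ DS (s ∷ []) (dsub k T u) ⟧ₛ m
                                        ≈⟨ ⟦++⟧ (DS (dsub k T s) (u ∷ [])) (DS (s ∷ []) (dsub k T u)) m ⟩
    ⟦ DS (dsub k T s) (u ∷ []) ⟧ₛ m + ⟦ DS (s ∷ []) (dsub k T u) ⟧ₛ m
                                        ≈⟨ ≈-trans (⟦DS⟧ (dsub k T s) (u ∷ []) m) (Dapᵐ-cong₂ (⟦dsub⟧ k m k<m T s) (⟦[ u ]⟧ m)) ⟩+⟨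
                                           ≈-trans (⟦DS⟧ (s ∷ []) (dsub k T u) m) (Dapᵐ-cong₂ (⟦[ s ]⟧ m) (⟦dsub⟧ k m k<m T u)) ⟩
    Dapᵐ (∂ (⟦ s ⟧ m) v) (⟦ u ⟧ m) + Dapᵐ (⟦ s ⟧ m) (∂ (⟦ u ⟧ m) v)
                                        ≈⟨ ∂-Dapᵐ _ _ v ⟨
    ∂ (⟦ Dap s u ⟧ m) v                 ∎
    where v = injectAt k m (⟦ T ⟧ₛ m)
  ⟦dsubL⟧ k m k<m T [] = ≈-sym (D0-at _)
  ⟦dsubL⟧ k m k<m T (u ∷ S) = ≈-trans (⟦++⟧ (dsub k T u) (dsubL k T S) m)
    (≈-trans (⟦dsub⟧ k m k<m T u ⟩+⟨ ⟦dsubL⟧ k m k<m T S) (≈-sym (D+-at _ _ _)))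

  ⟦⟧ₛ-weaken : ∀ m S → AdequateL m S → ⟦ S ⟧ₛ (suc m) ≈ ⟦ S ⟧ₛ m ∘ omitAt m m
  ⟦⟧ₛ-weaken m S a = ≡.subst (λ S′ → ⟦ S′ ⟧ₛ (suc m) ≈ ⟦ S ⟧ₛ m ∘ omitAt m m)
                             (shiftL-fresh m S a) (⟦shiftL⟧ m m ≤-refl S)

  Agree : ℕ → DTerm → DTerm → Set e
  Agree n S T = AdequateL n S × AdequateL n T × ⟦ S ⟧ₛ n ≈ ⟦ T ⟧ₛ n

  Agree-suc : ∀ {n} S T → Agree n S T → Agree (suc n) S T
  Agree-suc {n} S T (a , b , e) =
    AdequateL-mono (n≤1+n n) S a , AdequateL-mono (n≤1+n n) T b ,
    ≈-trans (⟦⟧ₛ-weaken n S a) (≈-trans (e ⟩∘⟨refl) (≈-sym (⟦⟧ₛ-weaken n T b)))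

  Agree-mono : ∀ {n N} S T → n ≤ N → Agree n S T → Agree N S T
  Agree-mono {n} S T n≤N = go (≤⇒≤′ n≤N)
    where
    go : ∀ {N} → n ≤′ N → Agree n S T → Agree N S T
    go ≤′-refl agree = agree
    go (≤′-step n≤′N) agree = Agree-suc S T (go n≤′N agree)

  Th-joint : ∀ S T S′ T′ → Th S T → Th S′ T′ → Σ ℕ λ N → Agree N S T × Agree N S′ T′
  Th-joint S T S′ T′ (n , p) (m , q) =
    n ⊔ m , Agree-mono S T (m≤m⊔n n m) p , Agree-mono S′ T′ (m≤n⊔m n m) q

  Th-by-≈ : ∀ S T → (∀ N → ⟦ S ⟧ₛ N ≈ ⟦ T ⟧ₛ N) → Th S T
  Th-by-≈ S T eq =
    boundL S ⊔ boundL T ,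
    AdequateL-mono (m≤m⊔n _ _) S (AdequateL-bound S) , AdequateL-mono (m≤n⊔m _ _) T (AdequateL-bound T) ,
    eq _

  Th-isEquivalence : IsEquivalence Th
  Th-isEquivalence = record
    { refl = λ {S} → Th-by-≈ S S (λ _ → ≈-refl)
    ; sym = λ { (n , a , b , e) → n , b , a , ≈-sym e }
    ; trans = Th-trans
    }
    where
    Th-trans : ∀ {S T V} → Th S T → Th T V → Th S V
    Th-trans {S} {T} {V} p q with Th-joint S T T V p q
    ... | N , (a , _ , e) , (_ , c , e′) = N , a , c , ≈-trans e e′

  Th-lam : ∀ {s S} → Th (s ∷ []) S → Th (lam s ∷ []) (lamS S)
  Th-lam {s} {S} (n , agree) with Agree-suc (s ∷ []) S agree
  ... | (a , _) , b , e = n , (a , _) , AdequateL-lamS S b ,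
    ≈-trans (⟦[ lam s ]⟧ n) (≈-trans (lamᵐ-cong (≈-trans (≈-sym (⟦[ s ]⟧ _)) e)) (≈-sym (⟦lamS⟧ S n)))

  Th-app : ∀ {s S T V} → Th (s ∷ []) S → Th T V → Th (app s T ∷ []) (appS S V)
  Th-app {s} {S} {T} {V} p q with Th-joint (s ∷ []) S T V p q
  ... | N , ((a , _) , b , e) , (c , d , e′) = N , ((a , c) , _) , AdequateL-appS S V b d ,
    ≈-trans (⟦[ app s T ]⟧ N)
      (≈-trans (appᵐ-cong₂ (≈-trans (≈-sym (⟦[ s ]⟧ N)) e) e′) (≈-sym (⟦appS⟧ S V N)))

  Th-Dap : ∀ {s S u V} → Th (s ∷ []) S → Th (u ∷ []) V → Th (Dap s u ∷ []) (DS S V)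
  Th-Dap {s} {S} {u} {V} p q with Th-joint (s ∷ []) S (u ∷ []) V p q
  ... | N , ((a , _) , b , e) , ((c , _) , d , e′) = N , ((a , c) , _) , AdequateL-DS S V b d ,
    ≈-trans (⟦[ Dap s u ]⟧ N)
      (≈-trans (Dapᵐ-cong₂ (≈-trans (≈-sym (⟦[ s ]⟧ N)) e) (≈-trans (≈-sym (⟦[ u ]⟧ N)) e′))
               (≈-sym (⟦DS⟧ S V N)))

  Th-sum : ∀ {ss SS} → Pointwise (λ s S → Th (s ∷ []) S) ss SS → Th ss (concat SS)
  Th-sum [] = 0 , _ , _ , ≈-refl
  Th-sum {s ∷ ss} {S ∷ SS} (p ∷ ps) with Th-joint (s ∷ []) S ss (concat SS) p (Th-sum ps)
  ... | N , ((a , _) , b , e) , (c , d , e′) = N , (a , c) , AdequateL-++ S (concat SS) b d ,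
    ≈-trans (≈-trans (≈-sym (⟦[ s ]⟧ N)) e ⟩+⟨ e′) (≈-sym (⟦++⟧ S (concat SS) N))

  Th-↭ : ∀ {S T} → S ↭ T → Th S T
  Th-↭ {S} {T} p = Th-by-≈ S T (⟦↭⟧ p)

  Th-Dap-exchange : ∀ s t u → Th (Dap (Dap s t) u ∷ []) (Dap (Dap s u) t ∷ [])
  Th-Dap-exchange s t u = Th-by-≈ (Dap (Dap s t) u ∷ []) (Dap (Dap s u) t ∷ []) λ _ → Dapᵐ-exchange _ _ _ ⟩+⟨ ≈-refl

  Th-β : ∀ s T → Th (app (lam s) T ∷ []) (subst 0 T s)
  Th-β s T = Th-by-≈ (app (lam s) T ∷ []) (subst 0 T s) λ N → begin
    ⟦ app (lam s) T ∷ [] ⟧ₛ N                  ≈⟨ ⟦[ app (lam s) T ]⟧ N ⟩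
    appᵐ (lamᵐ (⟦ s ⟧ (suc N))) (⟦ T ⟧ₛ N)     ≈⟨ appᵐ-lamᵐ _ _ ⟩
    ⟦ s ⟧ (suc N) ∘ ⟨ id , ⟦ T ⟧ₛ N ⟩          ≈⟨ ⟦subst⟧ 0 N z≤n T s ⟨
    ⟦ subst 0 T s ⟧ₛ N                         ∎

  Th-βD : ∀ s t → Th (Dap (lam s) t ∷ []) (lamS (dsub 0 (shift 0 t ∷ []) s))
  Th-βD s t = Th-by-≈ (Dap (lam s) t ∷ []) (lamS (dsub 0 (shift 0 t ∷ []) s)) agree
    where
    agree : ∀ N → ⟦ Dap (lam s) t ∷ [] ⟧ₛ N ≈ ⟦ lamS (dsub 0 (shift 0 t ∷ []) s) ⟧ₛ N
    agree N = begin
      ⟦ Dap (lam s) t ∷ [] ⟧ₛ N                                  ≈⟨ ⟦[ Dap (lam s) t ]⟧ N ⟩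
      Dapᵐ (lamᵐ f) (⟦ t ⟧ N)                                    ≈⟨ Dapᵐ-lamᵐ _ _ ⟩
      lamᵐ (f ⋆ ⟦ t ⟧ N)                                         ≈⟨ lamᵐ-cong (refl⟩∘⟨ ⟨⟩-cong₂ (⟨⟩-cong₂ ≈-refl shifted) ≈-refl) ⟨
      lamᵐ (∂ f (injectAt 0 (suc N) (⟦ shift 0 t ∷ [] ⟧ₛ (suc N))))
                                                                 ≈⟨ lamᵐ-cong (⟦dsub⟧ 0 (suc N) (s≤s z≤n) _ s) ⟨
      lamᵐ (⟦ dsub 0 (shift 0 t ∷ []) s ⟧ₛ (suc N))              ≈⟨ ⟦lamS⟧ (dsub 0 (shift 0 t ∷ []) s) N ⟨
      ⟦ lamS (dsub 0 (shift 0 t ∷ []) s) ⟧ₛ N                    ∎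
      where
      f = ⟦ s ⟧ (suc N)
      shifted : ⟦ shift 0 t ∷ [] ⟧ₛ (suc N) ≈ ⟦ t ⟧ N ∘ π₁
      shifted = ≈-trans (⟦[ shift 0 t ]⟧ _) (⟦shift⟧ 0 N z≤n t)

theorem4p11 : ∀ {o ℓ e : Level} (C : CartesianClosedDifferentialCategory o ℓ e)
                (𝒰 : LinearReflexiveObject C) →
                IsDifferentialλTheory (Interpretation.Th 𝒰)
theorem4p11 C 𝒰 = record
  { isEquivalence = Th-isEquivalence
  ; sum-perm = Th-↭
  ; D-perm = Th-Dap-exchange
  ; compat-lam = λ {s} {S} → Th-lam {s} {S}
  ; compat-app = λ {s} {S} {T} {V} → Th-app {s} {S} {T} {V}
  ; compat-D = λ {s} {S} {u} {V} → Th-Dap {s} {S} {u} {V}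
  ; compat-sum = Th-sum
  ; β = Th-β
  ; βD = Th-βD
  }
  where open Soundness 𝒰
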